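{- For all $n \ge 2$, $$|S_n(132, 654213, 2341)| = 5F_{n+6} + F_{n+4} - 4\binom{n+1}{4} - 7\binom{n+1}{3} - 5\binom{n+1}{2} - 27\binom{n+1}{1} - 8.$$ Moreover, the generating function $f(x) = \sum_{n=0}^\infty |S_n(132, 654213, 2341)|\, x^n$ is given by $$f(x) = \frac{2x^8 - x^7 - x^6 - 5x^5 - x^4 + 8x^3 - 10x^2 + 5x - 1}{(x^2 + x - 1)(1 - x)^5}.$$
   Context: Permutations of $[n]$ are written in one-line notation, and $S_n$ denotes the set of them. A permutation $\pi\in S_n$ contains $\sigma\in S_m$ if there are indices $i_1<\dots<i_m$ such that for all $a,b$, $\pi(i_a)<\pi(i_b)$ iff $\sigma(a)<\sigma(b)$; otherwise $\pi$ avoids $\sigma$. For a set $R$ of permutations, $S_n(R)$ is the set of $\pi\in S_n$ avoiding every element of $R$; $S_0(R)$ consists of the empty permutation only. $F_n$ denotes the Fibonacci numbers with $F_0=0$, $F_1=F_2=1$, $F_n=F_{n-1}+F_{n-2}$. -}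

module Defs where

open import Data.Nat as ℕ using (ℕ; zero; suc)
open import Data.Nat.Combinatorics using (_C_)
open import Data.Integer as ℤ using (ℤ; +_)
open import Data.Fin as Fin using (Fin; #_)
open import Data.Vec using (Vec; []; _∷_; lookup)
open import Data.List using (List; length; map; foldr; upTo)
open import Data.List.Relation.Unary.Unique.Propositional using (Unique)
open import Data.List.Membership.Propositional using (_∈_)
open import Data.Product using (Σ; ∃; _×_)
open import Relation.Binary.PropositionalEquality using (_≡_)
open import Relation.Nullary using (¬_)

F : ℕ → ℕ
F zero = 0
F (suc zero) = 1
F (suc (suc n)) = F (suc n) ℕ.+ F n

-- A permutation of [n] in one-line notation, with values shifted to {0,…,n-1}:
-- a vector of length n whose entry map is a bijection Fin n → Fin n.
IsPerm : {n : ℕ} → Vec (Fin n) n → Set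
IsPerm {n} v =
  (∀ (i j : Fin n) → lookup v i ≡ lookup v j → i ≡ j) ×
  (∀ (k : Fin n) → ∃ λ i → lookup v i ≡ k)

Contains : {n m : ℕ} → Vec (Fin n) n → Vec (Fin m) m → Set
Contains {n} {m} π σ =
  Σ (Fin m → Fin n) λ ι →
    (∀ (a b : Fin m) → a Fin.< b → ι a Fin.< ι b) ×
    (∀ (a b : Fin m) →
       (lookup π (ι a) Fin.< lookup π (ι b) → lookup σ a Fin.< lookup σ b) ×
       (lookup σ a Fin.< lookup σ b → lookup π (ι a) Fin.< lookup π (ι b)))

Avoids : {n m : ℕ} → Vec (Fin n) n → Vec (Fin m) m → Set
Avoids π σ = ¬ Contains π σ

-- The patterns 132, 654213, 2341 (values shifted down by one)
p132 : Vec (Fin 3) 3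
p132 = # 0 ∷ # 2 ∷ # 1 ∷ []

p654213 : Vec (Fin 6) 6
p654213 = # 5 ∷ # 4 ∷ # 3 ∷ # 1 ∷ # 0 ∷ # 2 ∷ []

p2341 : Vec (Fin 4) 4
p2341 = # 1 ∷ # 2 ∷ # 3 ∷ # 0 ∷ []

InClass : {n : ℕ} → Vec (Fin n) n → Set
InClass π = IsPerm π × Avoids π p132 × Avoids π p654213 × Avoids π p2341

ClassCard : ℕ → ℕ → Set
ClassCard n k =
  Σ (List (Vec (Fin n) n)) λ L →
    Unique L × length L ≡ k ×
    (∀ (π : Vec (Fin n) n) → (π ∈ L → InClass π) × (InClass π → π ∈ L))

formula : ℕ → ℤ
formula n =
  ((+ (5 ℕ.* F (n ℕ.+ 6) ℕ.+ F (n ℕ.+ 4)))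
    ℤ.- + (4 ℕ.* ((n ℕ.+ 1) C 4))
    ℤ.- + (7 ℕ.* ((n ℕ.+ 1) C 3))
    ℤ.- + (5 ℕ.* ((n ℕ.+ 1) C 2))
    ℤ.- + (27 ℕ.* ((n ℕ.+ 1) C 1)))
    ℤ.- + 8

Series : Set
Series = ℕ → ℤ

-- polynomial given by its coefficient list (constant term first)
poly : List ℤ → Series
poly List.[] _ = + 0
poly (c List.∷ cs) zero = c
poly (c List.∷ cs) (suc i) = poly cs i

_⋆_ : Series → Series → Series
(a ⋆ b) m = foldr ℤ._+_ (+ 0) (map (λ i → a i ℤ.* b (m ℕ.∸ i)) (upTo (suc m)))

-- numerator 2x^8 - x^7 - x^6 - 5x^5 - x^4 + 8x^3 - 10x^2 + 5x - 1
numerator : Series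
numerator = poly (ℤ.-[1+ 0 ] List.∷ + 5 List.∷ ℤ.-[1+ 9 ] List.∷ + 8 List.∷ ℤ.-[1+ 0 ]
                  List.∷ ℤ.-[1+ 4 ] List.∷ ℤ.-[1+ 0 ] List.∷ ℤ.-[1+ 0 ] List.∷ + 2 List.∷ List.[])

oneMinusX : Series
oneMinusX = poly (+ 1 List.∷ ℤ.-[1+ 0 ] List.∷ List.[])

denominator : Series
denominator =
  poly (ℤ.-[1+ 0 ] List.∷ + 1 List.∷ + 1 List.∷ List.[])
    ⋆ (oneMinusX ⋆ (oneMinusX ⋆ (oneMinusX ⋆ (oneMinusX ⋆ oneMinusX))))

module Submission where

-- A 132-avoider with maximum n reads α n β with every entry of α above every entry of β, and
-- an occurrence of a pattern in α n β splits accordingly into occurrences in α and in β. If β is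
-- nonempty, avoiding 2341 forces α to be decreasing; an occurrence of 654213 can then take its
-- leading decreasing run from n or from α, so β only has to avoid 54213, 4213 or 213, depending
-- on the length of α. Sorting the avoiders by the position of their maximum gives linear
-- recurrences for the counts at these four levels, solved by Fibonacci numbers plus polynomials
-- in n; the annihilator (x² + x − 1)(1 − x)⁵ of such sequences yields the generating function.

module Patterns where
  open import Data.Nat using (ℕ; _<_; _≤_; suc)
  open import Data.Nat.Properties using (<-asym)
  open import Data.List using (List; []; _∷_; length)
  open import Data.List.Relation.Binary.Pointwise as Pw using (Pointwise; []; _∷_)
  open import Data.List.Relation.Binary.Sublist.Propositional {A = ℕ} using (_⊆_; []; _∷_; _∷ʳ_; ⊆-trans)
  open import Data.List.Relation.Binary.Sublist.Propositional.Properties using ([]⊆-universal; length-mono-≤)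
  open import Data.Product using (∃-syntax; _×_; _,_)
  open import Data.Empty using (⊥-elim)
  open import Function using (_⇔_; mk⇔; Equivalence)
  open import Relation.Binary.PropositionalEquality using (_≡_; refl; subst; cong)
  open import Relation.Nullary using (¬_)
  open Equivalence using (to; from)

  SameOrder : ℕ → ℕ → ℕ → ℕ → Set
  SameOrder x y x′ y′ = (x < x′ ⇔ y < y′) × (x′ < x ⇔ y′ < y)

  data OrderIso : List ℕ → List ℕ → Set where
    [] : OrderIso [] []
    _∷_ : ∀ {x y xs ys} → Pointwise (SameOrder x y) xs ys → OrderIso xs ys → OrderIso (x ∷ xs) (y ∷ ys)

  infix 4 _contains_
  _contains_ : List ℕ → List ℕ → Set
  π contains σ = ∃[ s ] s ⊆ π × OrderIso s σ

  SameOrder-refl : ∀ {x x′} → SameOrder x x x′ x′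
  SameOrder-refl = mk⇔ (λ h → h) (λ h → h) , mk⇔ (λ h → h) (λ h → h)

  SameOrder-trans : ∀ {x y z x′ y′ z′} → SameOrder x y x′ y′ → SameOrder y z y′ z′ → SameOrder x z x′ z′
  SameOrder-trans (p , q) (p′ , q′) =
    mk⇔ (λ h → to p′ (to p h)) (λ h → from p (from p′ h)) ,
    mk⇔ (λ h → to q′ (to q h)) (λ h → from q (from q′ h))

  SameOrder-below : ∀ {x y x′ y′} → x′ < x → y′ < y → SameOrder x y x′ y′
  SameOrder-below h h′ = mk⇔ (λ q → ⊥-elim (<-asym q h)) (λ q → ⊥-elim (<-asym q h′)) , mk⇔ (λ _ → h′) (λ _ → h)

  SameOrder-above : ∀ {x y x′ y′} → x < x′ → y < y′ → SameOrder x y x′ y′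
  SameOrder-above h h′ = mk⇔ (λ _ → h′) (λ _ → h) , mk⇔ (λ q → ⊥-elim (<-asym q h)) (λ q → ⊥-elim (<-asym q h′))

  OrderIso-refl : ∀ xs → OrderIso xs xs
  OrderIso-refl [] = []
  OrderIso-refl (x ∷ xs) = Pw.refl SameOrder-refl ∷ OrderIso-refl xs

  OrderIso-trans : ∀ {as bs cs} → OrderIso as bs → OrderIso bs cs → OrderIso as cs
  OrderIso-trans [] [] = []
  OrderIso-trans (p ∷ o) (q ∷ o′) = Pw.transitive SameOrder-trans p q ∷ OrderIso-trans o o′

  OrderIso-length : ∀ {as bs} → OrderIso as bs → length as ≡ length bs
  OrderIso-length [] = refl
  OrderIso-length (_ ∷ o) = cong suc (OrderIso-length o)

  select : ∀ {σ′ σ} → σ′ ⊆ σ → List ℕ → List ℕ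
  select [] _ = []
  select (_ ∷ʳ p) [] = []
  select (_ ∷ʳ p) (_ ∷ s) = select p s
  select (_ ∷ p) [] = []
  select (_ ∷ p) (x ∷ s) = x ∷ select p s

  select-⊆ : ∀ {σ′ σ} (p : σ′ ⊆ σ) s → select p s ⊆ s
  select-⊆ [] s = []⊆-universal s
  select-⊆ (_ ∷ʳ p) [] = []
  select-⊆ (_ ∷ʳ p) (x ∷ s) = x ∷ʳ select-⊆ p s
  select-⊆ (_ ∷ p) [] = []
  select-⊆ (_ ∷ p) (x ∷ s) = refl ∷ select-⊆ p s

  Pointwise-select : ∀ {R : ℕ → ℕ → Set} {σ′ σ s} (p : σ′ ⊆ σ) → Pointwise R s σ → Pointwise R (select p s) σ′
  Pointwise-select [] [] = []
  Pointwise-select (_ ∷ʳ p) (_ ∷ q) = Pointwise-select p q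
  Pointwise-select (refl ∷ p) (r ∷ q) = r ∷ Pointwise-select p q

  OrderIso-select : ∀ {σ′ σ s} (p : σ′ ⊆ σ) → OrderIso s σ → OrderIso (select p s) σ′
  OrderIso-select [] [] = []
  OrderIso-select (_ ∷ʳ p) (_ ∷ o) = OrderIso-select p o
  OrderIso-select (refl ∷ p) (r ∷ o) = Pointwise-select p r ∷ OrderIso-select p o

  contains-trans : ∀ {π σ τ} → π contains σ → σ contains τ → π contains τ
  contains-trans (s , s⊆π , o) (u , u⊆σ , o′) =
    select u⊆σ s , ⊆-trans (select-⊆ u⊆σ s) s⊆π , OrderIso-trans (OrderIso-select u⊆σ o) o′

  contains-⊆ : ∀ {π π′ σ} → π ⊆ π′ → π contains σ → π′ contains σ
  contains-⊆ p (s , q , o) = s , ⊆-trans q p , o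

  ⊆⇒contains : ∀ {σ π} → σ ⊆ π → π contains σ
  ⊆⇒contains {σ} p = σ , p , OrderIso-refl σ

  contains-length : ∀ {π σ} → π contains σ → length σ ≤ length π
  contains-length (s , p , o) = subst (_≤ _) (OrderIso-length o) (length-mono-≤ p)

  contains-[] : ∀ π → π contains []
  contains-[] π = [] , []⊆-universal π , []

  contains-singleton : ∀ {y β} → (y ∷ β) contains (0 ∷ [])
  contains-singleton {y} {β} = y ∷ [] , refl ∷ []⊆-universal β , [] ∷ []

  ¬[]-contains-∷ : ∀ {x σ} → ¬ [] contains (x ∷ σ)
  ¬[]-contains-∷ c with contains-length c
  ... | ()

module MaxSplit where
  open import Data.Nat using (ℕ; _<_; _≤_; _≤?_; _<?_; z≤n; s≤s)
  open import Data.Nat.Properties using (suc-injective)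
  open import Data.List using (List; []; _∷_; _++_; length; map; concatMap; filter)
  open import Data.List.Properties using (++-assoc; ++-identityʳ)
  open import Data.List.Relation.Binary.Pointwise as Pw using (Pointwise; []; _∷_)
  open import Data.List.Relation.Binary.Sublist.Propositional {A = ℕ} using (_⊆_; []; _∷_; _∷ʳ_)
  open import Data.List.Relation.Binary.Sublist.Propositional.Properties using (++⁺; All-resp-⊆)
  open import Data.List.Relation.Unary.All as All using (All; []; _∷_)
  open import Data.List.Relation.Unary.Any using (Any; here; there)
  open import Data.List.Membership.Propositional using (_∈_; find; lose)
  open import Data.List.Membership.Propositional.Properties using (∈-map⁺; ∈-map⁻; ∈-concatMap⁺; ∈-concatMap⁻; ∈-filter⁺; ∈-filter⁻)
  open import Data.Product using (∃-syntax; _×_; _,_; proj₁; proj₂)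
  import Data.List.Relation.Unary.All.Properties as AllP
  open import Function using (_⇔_; mk⇔; Equivalence)
  open import Relation.Binary.PropositionalEquality using (_≡_; refl; sym; trans; subst; cong)
  open import Relation.Nullary using (Dec; _×-dec_)
  open import Relation.Unary using (Decidable)
  open Patterns
  open Equivalence using (to)

  Above : List ℕ → List ℕ → Set
  Above a b = All (λ x → All (_< x) b) a

  Above-⊆ : ∀ {a a′ b b′} → a′ ⊆ a → b′ ⊆ b → Above a b → Above a′ b′
  Above-⊆ p q g = All.map (All-resp-⊆ q) (All-resp-⊆ p g)

  Above-++ : ∀ {a a′ b} → Above a b → Above a′ b → Above (a ++ a′) b
  Above-++ g g′ = AllP.++⁺ g g′

  Above-transpose : ∀ {a b} → Above a b → All (λ y → All (y <_) a) b
  Above-transpose g = All.tabulate λ y∈b → All.tabulate λ x∈a → All.lookup (All.lookup g x∈a) y∈b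

  Above-untranspose : ∀ {a b} → All (λ y → All (y <_) a) b → Above a b
  Above-untranspose h = All.tabulate λ x∈a → All.tabulate λ y∈b → All.lookup (All.lookup h y∈b) x∈a

  above? : ∀ a b → Dec (Above a b)
  above? a b = All.all? (λ x → All.all? (_<? x) b) a

  Pointwise-All : ∀ {R : ℕ → ℕ → Set} {P Q : ℕ → Set} {s σ} → (∀ {x y} → R x y → P x → Q y) →
    Pointwise R s σ → All P s → All Q σ
  Pointwise-All f [] [] = []
  Pointwise-All f (r ∷ rs) (p ∷ ps) = f r p ∷ Pointwise-All f rs ps

  Pointwise-fromAll : ∀ {R : ℕ → ℕ → Set} {P Q : ℕ → Set} {s σ} → (∀ {x y} → P x → Q y → R x y) →
    length s ≡ length σ → All P s → All Q σ → Pointwise R s σ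
  Pointwise-fromAll {s = []} {[]} f _ [] [] = []
  Pointwise-fromAll {s = _ ∷ _} {_ ∷ _} f e (p ∷ ps) (q ∷ qs) = f p q ∷ Pointwise-fromAll f (suc-injective e) ps qs

  Pointwise-++⁻ : ∀ {R : ℕ → ℕ → Set} a {b c d} → length a ≡ length c →
    Pointwise R (a ++ b) (c ++ d) → Pointwise R a c × Pointwise R b d
  Pointwise-++⁻ [] {c = []} _ p = [] , p
  Pointwise-++⁻ (_ ∷ a) {c = _ ∷ _} e (r ∷ p) with Pointwise-++⁻ a (suc-injective e) p
  ... | p₁ , p₂ = r ∷ p₁ , p₂

  ⊆-++⁻ : ∀ u {v s} → s ⊆ u ++ v → ∃[ s₁ ] ∃[ s₂ ] s ≡ s₁ ++ s₂ × s₁ ⊆ u × s₂ ⊆ v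
  ⊆-++⁻ [] p = [] , _ , refl , [] , p
  ⊆-++⁻ (x ∷ u) (.x ∷ʳ p) with ⊆-++⁻ u p
  ... | s₁ , s₂ , refl , q₁ , q₂ = s₁ , s₂ , refl , x ∷ʳ q₁ , q₂
  ⊆-++⁻ (x ∷ u) (refl ∷ p) with ⊆-++⁻ u p
  ... | s₁ , s₂ , refl , q₁ , q₂ = x ∷ s₁ , s₂ , refl , refl ∷ q₁ , q₂

  -- Every entry of s₁ relates to every entry of s₂ as its partner in σ₁ does to the partner in σ₂.
  Cross : List ℕ → List ℕ → List ℕ → List ℕ → Set
  Cross s₁ σ₁ s₂ σ₂ = Pointwise (λ x y → Pointwise (SameOrder x y) s₂ σ₂) s₁ σ₁

  OrderIso-++⁻ : ∀ s₁ {s₂ σ} → OrderIso (s₁ ++ s₂) σ →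
    ∃[ σ₁ ] ∃[ σ₂ ] σ ≡ σ₁ ++ σ₂ × OrderIso s₁ σ₁ × OrderIso s₂ σ₂ × Cross s₁ σ₁ s₂ σ₂
  OrderIso-++⁻ [] o = [] , _ , refl , [] , o , []
  OrderIso-++⁻ (x ∷ s₁) (pw ∷ o) with OrderIso-++⁻ s₁ o
  ... | σ₁ , σ₂ , refl , o₁ , o₂ , cr with Pointwise-++⁻ s₁ (OrderIso-length o₁) pw
  ... | p₁ , p₂ = _ ∷ σ₁ , σ₂ , refl , p₁ ∷ o₁ , o₂ , p₂ ∷ cr

  OrderIso-++⁺ : ∀ {s₁ σ₁ s₂ σ₂} → OrderIso s₁ σ₁ → OrderIso s₂ σ₂ → Cross s₁ σ₁ s₂ σ₂ →
    OrderIso (s₁ ++ s₂) (σ₁ ++ σ₂)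
  OrderIso-++⁺ [] o₂ [] = o₂
  OrderIso-++⁺ (p ∷ o₁) o₂ (c ∷ cr) = Pw.++⁺ p c ∷ OrderIso-++⁺ o₁ o₂ cr

  Cross⇒Above : ∀ {s₁ σ₁ s₂ σ₂} → Cross s₁ σ₁ s₂ σ₂ → Above s₁ s₂ → Above σ₁ σ₂
  Cross⇒Above = Pointwise-All (Pointwise-All (λ c → to (proj₂ c)))

  Cross⇒Below : ∀ {s₁ σ₁ s₂ σ₂} → Cross s₁ σ₁ s₂ σ₂ → Above s₂ s₁ → Above σ₂ σ₁
  Cross⇒Below cr g = Above-untranspose (Pointwise-All (Pointwise-All (λ c → to (proj₁ c))) cr (Above-transpose g))

  Above⇒Cross : ∀ {s₁ σ₁ s₂ σ₂} → OrderIso s₁ σ₁ → OrderIso s₂ σ₂ → Above s₁ s₂ → Above σ₁ σ₂ → Cross s₁ σ₁ s₂ σ₂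
  Above⇒Cross o₁ o₂ =
    Pointwise-fromAll (Pointwise-fromAll SameOrder-below (OrderIso-length o₂)) (OrderIso-length o₁)

  Below⇒Cross : ∀ {s₁ σ₁ s₂ σ₂} → OrderIso s₁ σ₁ → OrderIso s₂ σ₂ → Above s₂ s₁ → Above σ₂ σ₁ → Cross s₁ σ₁ s₂ σ₂
  Below⇒Cross o₁ o₂ g h =
    Pointwise-fromAll (Pointwise-fromAll SameOrder-above (OrderIso-length o₂)) (OrderIso-length o₁)
      (Above-transpose g) (Above-transpose h)

  MaxSplit : List ℕ → ℕ → List ℕ → Set
  MaxSplit α M β = All (_< M) α × All (_< M) β × Above α β

  Split : Set
  Split = List ℕ × List ℕ × List ℕ

  joinSplit : Split → List ℕ
  joinSplit (a , m , b) = a ++ m ++ b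

  Admissible : Split → Set
  Admissible (a , m , b) = length m ≤ 1 × Above m a × Above (a ++ m) b

  Embeds : List ℕ → List ℕ → Split → Set
  Embeds α β (a , _ , b) = α contains a × β contains b

  Above-copies : ∀ {M ms l} → All (_≡ M) ms → All (_< M) l → Above ms l
  Above-copies ms≡M l<M = All.map (λ { refl → l<M }) ms≡M

  ⊆-∷⁻ : ∀ {M β s} → s ⊆ M ∷ β →
    ∃[ ms ] ∃[ sb ] s ≡ ms ++ sb × length ms ≤ 1 × All (_≡ M) ms × sb ⊆ β
  ⊆-∷⁻ (_ ∷ʳ p) = [] , _ , refl , z≤n , [] , p
  ⊆-∷⁻ (refl ∷ p) = _ ∷ [] , _ , refl , s≤s z≤n , refl ∷ [] , p

  ⊆-∷⁺ : ∀ M m → length m ≤ 1 →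
    ∃[ ms ] OrderIso ms m × All (_≡ M) ms × (∀ {sb β} → sb ⊆ β → ms ++ sb ⊆ M ∷ β)
  ⊆-∷⁺ M [] _ = [] , [] , [] , M ∷ʳ_
  ⊆-∷⁺ M (_ ∷ []) _ = M ∷ [] , [] ∷ [] , refl ∷ [] , refl ∷_
  ⊆-∷⁺ M (_ ∷ _ ∷ _) (s≤s ())

  contains-maxSplit⁻ : ∀ {α M β τ} → MaxSplit α M β → (α ++ M ∷ β) contains τ →
    ∃[ t ] τ ≡ joinSplit t × Admissible t × Embeds α β t
  contains-maxSplit⁻ {α} (α<M , β<M , α>β) (s , p , o) with ⊆-++⁻ α p
  ... | sa , s′ , refl , pa , p′ with ⊆-∷⁻ p′
  ... | ms , sb , refl , ms≤1 , ms≡M , pb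
      with OrderIso-++⁻ (sa ++ ms) (subst (λ z → OrderIso z _) (sym (++-assoc sa ms sb)) o)
  ... | τ₁ , b , refl , o₁ , ob , cr₁ with OrderIso-++⁻ sa o₁
  ... | a , m , refl , oa , om , cr₂ =
    (a , m , b) , ++-assoc a m b ,
    (subst (_≤ 1) (OrderIso-length om) ms≤1 ,
     Cross⇒Below cr₂ (Above-copies ms≡M (All-resp-⊆ pa α<M)) ,
     Cross⇒Above cr₁ (Above-++ (Above-⊆ pa pb α>β) (Above-copies ms≡M (All-resp-⊆ pb β<M)))) ,
    (sa , pa , oa) , (sb , pb , ob)

  contains-maxSplit⁺ : ∀ {α M β} t → MaxSplit α M β → Admissible t → Embeds α β t →
    (α ++ M ∷ β) contains joinSplit t
  contains-maxSplit⁺ {α} {M} {β} (a , m , b) (α<M , β<M , α>β) (m≤1 , m>a , am>b) ((sa , pa , oa) , (sb , pb , ob))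
    with ⊆-∷⁺ M m m≤1
  ... | ms , om , ms≡M , pm =
    (sa ++ ms) ++ sb ,
    subst (_⊆ _) (sym (++-assoc sa ms sb)) (++⁺ pa (pm pb)) ,
    subst (OrderIso _) (++-assoc a m b)
      (OrderIso-++⁺ oam ob (Above⇒Cross oam ob (Above-++ (Above-⊆ pa pb α>β) (Above-copies ms≡M (All-resp-⊆ pb β<M))) am>b))
    where
    oam : OrderIso (sa ++ ms) (a ++ m)
    oam = OrderIso-++⁺ oa om (Below⇒Cross oa om (Above-copies ms≡M (All-resp-⊆ pa α<M)) m>a)

  splits : List ℕ → List (List ℕ × List ℕ)
  splits [] = ([] , []) ∷ []
  splits (x ∷ xs) = ([] , x ∷ xs) ∷ map (λ (a , b) → x ∷ a , b) (splits xs)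

  middleChoices : List ℕ × List ℕ → List Split
  middleChoices (a , []) = (a , [] , []) ∷ []
  middleChoices (a , x ∷ b) = (a , [] , x ∷ b) ∷ (a , x ∷ [] , b) ∷ []

  splits₃ : List ℕ → List Split
  splits₃ τ = concatMap middleChoices (splits τ)

  admissible? : Decidable Admissible
  admissible? (a , m , b) = (length m ≤? 1) ×-dec above? m a ×-dec above? (a ++ m) b

  admissibleSplits : List ℕ → List Split
  admissibleSplits τ = filter admissible? (splits₃ τ)

  ∈-splits : ∀ a b → (a , b) ∈ splits (a ++ b)
  ∈-splits [] [] = here refl
  ∈-splits [] (_ ∷ _) = here refl
  ∈-splits (x ∷ a) b = there (∈-map⁺ _ (∈-splits a b))

  splits-∈ : ∀ τ {a b} → (a , b) ∈ splits τ → τ ≡ a ++ b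
  splits-∈ [] (here refl) = refl
  splits-∈ (x ∷ τ) (here refl) = refl
  splits-∈ (x ∷ τ) (there p) with ∈-map⁻ _ p
  ... | _ , q , refl = cong (x ∷_) (splits-∈ τ q)

  ∈-splits₃ : ∀ a m b → length m ≤ 1 → (a , m , b) ∈ splits₃ (a ++ m ++ b)
  ∈-splits₃ a [] [] _ = ∈-concatMap⁺ _ (lose (∈-splits a []) (here refl))
  ∈-splits₃ a [] (_ ∷ _) _ = ∈-concatMap⁺ _ (lose (∈-splits a _) (here refl))
  ∈-splits₃ a (x ∷ []) b _ = ∈-concatMap⁺ _ (lose (∈-splits a (x ∷ b)) (there (here refl)))
  ∈-splits₃ a (_ ∷ _ ∷ _) b (s≤s ())

  splits₃-∈ : ∀ τ {t} → t ∈ splits₃ τ → τ ≡ joinSplit t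
  splits₃-∈ τ p with find (∈-concatMap⁻ middleChoices {xs = splits τ} p)
  ... | (a , []) , q , here refl = trans (splits-∈ τ q) (cong (a ++_) (++-identityʳ []))
  ... | (a , _ ∷ _) , q , here refl = splits-∈ τ q
  ... | (a , _ ∷ _) , q , there (here refl) = splits-∈ τ q

  contains-maxSplit⇔ : ∀ {α M β} τ → MaxSplit α M β →
    (α ++ M ∷ β) contains τ ⇔ Any (Embeds α β) (admissibleSplits τ)
  contains-maxSplit⇔ {α} {M} {β} τ sh = mk⇔ to′ from′
    where
    to′ : (α ++ M ∷ β) contains τ → Any (Embeds α β) (admissibleSplits τ)
    to′ c with contains-maxSplit⁻ sh c
    ... | (a , m , b) , refl , adm , emb = lose (∈-filter⁺ admissible? (∈-splits₃ a m b (proj₁ adm)) adm) emb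
    from′ : Any (Embeds α β) (admissibleSplits τ) → (α ++ M ∷ β) contains τ
    from′ any with find any
    ... | t , t∈ , emb with ∈-filter⁻ admissible? t∈
    ... | t∈′ , adm rewrite splits₃-∈ τ t∈′ = contains-maxSplit⁺ t sh adm emb

module Monotone where
  open import Data.Nat using (ℕ; _<_; _>_; _≤_; _<?_; zero; suc; z≤n; s≤s)
  open import Data.Nat.Properties using (<-cmp; suc-injective)
  open import Data.List using (List; []; _∷_; length)
  open import Data.List.Relation.Binary.Sublist.Propositional {A = ℕ} using (_⊆_; []; _∷_; _∷ʳ_; ⊆-refl; from∈)
  open import Data.List.Relation.Binary.Sublist.Propositional.Properties using ([]⊆-universal; All-resp-⊆)
  open import Data.List.Relation.Unary.All as All using (All; []; _∷_)
  open import Data.List.Relation.Unary.AllPairs using (AllPairs; []; _∷_; allPairs?)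
  open import Data.List.Relation.Unary.Unique.Propositional using (Unique)
  open import Data.List.Membership.Propositional using (_∈_)
  open import Data.Product using (∃-syntax; _×_; _,_; proj₁; proj₂)
  open import Data.Empty using (⊥-elim)
  open import Function using (Equivalence)
  open import Relation.Binary.Definitions using (tri<; tri≈; tri>)
  open import Relation.Binary.PropositionalEquality using (_≡_; _≢_; refl; cong)
  open import Relation.Nullary using (¬_; Dec)
  open import Relation.Nullary.Decidable using (True; fromWitness)
  open import Data.List.Relation.Binary.Pointwise using ([]; _∷_)
  open Patterns
  open MaxSplit using (Pointwise-All; Pointwise-fromAll)
  open Equivalence using (to)

  Decreasing : List ℕ → Set
  Decreasing = AllPairs _>_

  Increasing : List ℕ → Set
  Increasing = AllPairs _<_

  decreasing? : ∀ xs → Dec (Decreasing xs)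
  decreasing? = allPairs? (λ x y → y <? x)

  increasing? : ∀ xs → Dec (Increasing xs)
  increasing? = allPairs? _<?_

  AllPairs-resp-⊆ : ∀ {R : ℕ → ℕ → Set} {s α} → s ⊆ α → AllPairs R α → AllPairs R s
  AllPairs-resp-⊆ [] d = d
  AllPairs-resp-⊆ (_ ∷ʳ p) (_ ∷ d) = AllPairs-resp-⊆ p d
  AllPairs-resp-⊆ (refl ∷ p) (a ∷ d) = All-resp-⊆ p a ∷ AllPairs-resp-⊆ p d

  OrderIso-Decreasing : ∀ {s σ} → OrderIso s σ → Decreasing s → Decreasing σ
  OrderIso-Decreasing [] [] = []
  OrderIso-Decreasing (pw ∷ o) (a ∷ d) = Pointwise-All (λ c → to (proj₂ c)) pw a ∷ OrderIso-Decreasing o d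

  OrderIso-Increasing : ∀ {s σ} → OrderIso s σ → Increasing s → Increasing σ
  OrderIso-Increasing [] [] = []
  OrderIso-Increasing (pw ∷ o) (a ∷ d) = Pointwise-All (λ c → to (proj₁ c)) pw a ∷ OrderIso-Increasing o d

  -- Stated through True so that, for a concrete non-monotone pattern, the conclusion computes to ⊥.
  decreasing-contains : ∀ {α σ} → Decreasing α → α contains σ → True (decreasing? σ)
  decreasing-contains d (s , p , o) = fromWitness (OrderIso-Decreasing o (AllPairs-resp-⊆ p d))

  increasing-contains : ∀ {α σ} → Increasing α → α contains σ → True (increasing? σ)
  increasing-contains d (s , p , o) = fromWitness (OrderIso-Increasing o (AllPairs-resp-⊆ p d))

  Decreasing-OrderIso : ∀ {s σ} → Decreasing s → Decreasing σ → length s ≡ length σ → OrderIso s σ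
  Decreasing-OrderIso {[]} {[]} [] [] _ = []
  Decreasing-OrderIso {_ ∷ _} {_ ∷ _} (a ∷ d) (b ∷ d′) e =
    Pointwise-fromAll SameOrder-below (suc-injective e) a b ∷ Decreasing-OrderIso d d′ (suc-injective e)

  prefix-⊆ : ∀ n α → n ≤ length α → ∃[ s ] s ⊆ α × length s ≡ n
  prefix-⊆ zero α _ = [] , []⊆-universal α , refl
  prefix-⊆ (suc n) (x ∷ α) (s≤s h) with prefix-⊆ n α h
  ... | s , p , e = x ∷ s , refl ∷ p , cong suc e

  decreasing-contains-decreasing : ∀ {α σ} → Decreasing α → Decreasing σ → length σ ≤ length α → α contains σ
  decreasing-contains-decreasing {α} {σ} d d′ h with prefix-⊆ (length σ) α h
  ... | s , p , e = s , p , Decreasing-OrderIso (AllPairs-resp-⊆ p d) d′ e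

  ascent-contains-ascent : ∀ {x y x′ y′} → x < y → x′ < y′ → (x ∷ y ∷ []) contains (x′ ∷ y′ ∷ [])
  ascent-contains-ascent h h′ = _ , ⊆-refl , (SameOrder-above h h′ ∷ []) ∷ ([] ∷ [])

  contains-01 : ∀ {x z l} → z ∈ l → x < z → (x ∷ l) contains (0 ∷ 1 ∷ [])
  contains-01 z∈l x<z = contains-⊆ (refl ∷ from∈ z∈l) (ascent-contains-ascent x<z (s≤s z≤n))

  contains-10 : ∀ {x z l} → z ∈ l → z < x → (x ∷ l) contains (1 ∷ 0 ∷ [])
  contains-10 z∈l z<x = _ , refl ∷ from∈ z∈l , (SameOrder-below z<x (s≤s z≤n) ∷ []) ∷ ([] ∷ [])

  contains-∷ : ∀ {x l σ} → l contains σ → (x ∷ l) contains σ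
  contains-∷ {x} = contains-⊆ (x ∷ʳ ⊆-refl)

  avoids-01⇒Decreasing : ∀ {α} → Unique α → ¬ α contains (0 ∷ 1 ∷ []) → Decreasing α
  avoids-01⇒Decreasing {[]} _ _ = []
  avoids-01⇒Decreasing {x ∷ α} (x∉α ∷ u) av =
    All.tabulate (λ z∈α → below z∈α (All.lookup x∉α z∈α)) ∷ avoids-01⇒Decreasing u (λ c → av (contains-∷ c))
    where
    below : ∀ {z} → z ∈ α → x ≢ z → z < x
    below {z} z∈α x≢z with <-cmp z x
    ... | tri< z<x _ _ = z<x
    ... | tri≈ _ refl _ = ⊥-elim (x≢z refl)
    ... | tri> _ _ x<z = ⊥-elim (av (contains-01 z∈α x<z))

  avoids-10⇒Increasing : ∀ {α} → Unique α → ¬ α contains (1 ∷ 0 ∷ []) → Increasing α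
  avoids-10⇒Increasing {[]} _ _ = []
  avoids-10⇒Increasing {x ∷ α} (x∉α ∷ u) av =
    All.tabulate (λ z∈α → above z∈α (All.lookup x∉α z∈α)) ∷ avoids-10⇒Increasing u (λ c → av (contains-∷ c))
    where
    above : ∀ {z} → z ∈ α → x ≢ z → x < z
    above {z} z∈α x≢z with <-cmp z x
    ... | tri< z<x _ _ = ⊥-elim (av (contains-10 z∈α z<x))
    ... | tri≈ _ refl _ = ⊥-elim (x≢z refl)
    ... | tri> _ _ x<z = x<z

module Avoidance where
  open import Data.Nat using (ℕ; _<_; _≤_; _≤′_; _+_; _⊓_; pred; suc; z≤n; s≤s; ≤′-reflexive; ≤′-step)
  open import Data.Nat.Properties using (≤⇒≤′; ⊓-glb; ≤-refl; ≤-trans; pred-mono-≤; <-cmp)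
  open import Data.List using (List; []; _∷_; _++_; length)
  open import Data.List.Relation.Binary.Sublist.Propositional {A = ℕ} using (_∷ʳ_; ⊆-refl)
  open import Data.List.Relation.Binary.Sublist.Propositional.Properties using (++⁺ˡ; ++⁺ʳ)
  open import Data.List.Relation.Unary.All using (_∷_)
  open import Data.List.Relation.Unary.AllPairs using ([]; _∷_)
  open import Data.List.Relation.Unary.Any using (here; there)
  open import Data.List.Relation.Unary.Unique.Propositional using (Unique)
  open import Data.Product using (_×_; _,_; proj₁; proj₂)
  open import Data.Sum using (_⊎_; inj₁; inj₂)
  open import Data.Empty using (⊥-elim)
  open import Function using (Equivalence; _∘_)
  open import Relation.Binary.Definitions using (tri<; tri≈; tri>)
  open import Relation.Binary.PropositionalEquality using (_≡_; _≢_; refl)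
  open import Relation.Nullary using (¬_)
  open import Relation.Nullary.Decidable using (from-yes)
  open Patterns
  open MaxSplit
  open Monotone
  open Equivalence using (to; from)

  pattern132 : List ℕ
  pattern132 = 0 ∷ 2 ∷ 1 ∷ []

  pattern2341 : List ℕ
  pattern2341 = 1 ∷ 2 ∷ 3 ∷ 0 ∷ []

  -- 654213 with its t largest entries deleted; from t = 3 on this is 213.
  tailPattern : ℕ → List ℕ
  tailPattern 0 = 5 ∷ 4 ∷ 3 ∷ 1 ∷ 0 ∷ 2 ∷ []
  tailPattern 1 = 4 ∷ 3 ∷ 1 ∷ 0 ∷ 2 ∷ []
  tailPattern 2 = 3 ∷ 1 ∷ 0 ∷ 2 ∷ []
  tailPattern (suc (suc (suc _))) = 1 ∷ 0 ∷ 2 ∷ []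

  Avoider : ℕ → List ℕ → Set
  Avoider t xs = ¬ xs contains pattern132 × ¬ xs contains pattern2341 × ¬ xs contains tailPattern t

  -- In α M β with α decreasing of length k, the leading run of tailPattern t is covered either by
  -- the maximum M or by up to k entries of α, so β must avoid tailPattern (nextLevel t k).
  nextLevel : ℕ → ℕ → ℕ
  nextLevel t k = 3 ⊓ (suc t + pred k)

  ≤-nextLevel : ∀ {j} t k → j ≤ 3 → j ≤ suc t + pred k → j ≤ nextLevel t k
  ≤-nextLevel t k = ⊓-glb

  tailPattern-step : ∀ j → tailPattern j contains tailPattern (suc j)
  tailPattern-step 0 = ⊆⇒contains (5 ∷ʳ ⊆-refl)
  tailPattern-step 1 = ⊆⇒contains (4 ∷ʳ ⊆-refl)
  tailPattern-step 2 = ⊆⇒contains (3 ∷ʳ ⊆-refl)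
  tailPattern-step (suc (suc (suc j))) = ⊆⇒contains ⊆-refl

  tailPattern-mono : ∀ {β j j′} → j ≤ j′ → β contains tailPattern j → β contains tailPattern j′
  tailPattern-mono {β} {j} h = go (≤⇒≤′ h)
    where
    go : ∀ {j′} → j ≤′ j′ → β contains tailPattern j → β contains tailPattern j′
    go (≤′-reflexive refl) c = c
    go (≤′-step h) c = contains-trans (go h c) (tailPattern-step _)

  Avoider-[] : ∀ t → Avoider t []
  Avoider-[] 0 = ¬[]-contains-∷ , ¬[]-contains-∷ , ¬[]-contains-∷
  Avoider-[] 1 = ¬[]-contains-∷ , ¬[]-contains-∷ , ¬[]-contains-∷
  Avoider-[] 2 = ¬[]-contains-∷ , ¬[]-contains-∷ , ¬[]-contains-∷
  Avoider-[] (suc (suc (suc _))) = ¬[]-contains-∷ , ¬[]-contains-∷ , ¬[]-contains-∷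

  1<2 : 1 < 2
  1<2 = s≤s (s≤s z≤n)

  module _ {α M β} (sh : MaxSplit α M β) where

    contains-left : ∀ {σ} → α contains σ → (α ++ M ∷ β) contains σ
    contains-left = contains-⊆ (++⁺ʳ (M ∷ β) ⊆-refl)

    contains-right : ∀ {σ} → β contains σ → (α ++ M ∷ β) contains σ
    contains-right = contains-⊆ (++⁺ˡ α (M ∷ʳ ⊆-refl))

    avoids132 : ¬ α contains pattern132 → ¬ β contains pattern132 → ¬ (α ++ M ∷ β) contains pattern132
    avoids132 a b c with to (contains-maxSplit⇔ pattern132 sh) c
    ... | here (_ , cb) = b cb
    ... | there (here (ca , _)) = a ca

    contains2341 : α contains (0 ∷ 1 ∷ []) → β contains (0 ∷ []) → (α ++ M ∷ β) contains pattern2341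
    contains2341 ca cb =
      from (contains-maxSplit⇔ pattern2341 sh) (there (here (contains-trans ca (ascent-contains-ascent (s≤s z≤n) 1<2) , cb)))

    avoids2341 : ¬ α contains pattern2341 → ¬ β contains pattern2341 →
      ¬ (α contains (0 ∷ 1 ∷ []) × β contains (0 ∷ [])) → ¬ (α ++ M ∷ β) contains pattern2341
    avoids2341 a b x c with to (contains-maxSplit⇔ pattern2341 sh) c
    ... | here (_ , cb) = b cb
    ... | there (here (ca , cb)) = x (contains-trans ca (contains-01 (here refl) 1<2) , cb)
    ... | there (there (here (ca , cb))) = x (contains-trans ca (contains-01 (here refl) 1<2) , cb)
    ... | there (there (there (here (ca , _)))) = a ca

  contains-tailPattern : ∀ t {α M β} → t ≤ 2 → MaxSplit α M β → Decreasing α →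
    β contains tailPattern (nextLevel t (length α)) → (α ++ M ∷ β) contains tailPattern t
  contains-tailPattern 0 {[]} _ sh d c = from (contains-maxSplit⇔ (tailPattern 0) sh) (there (here (contains-[] _ , c)))
  contains-tailPattern 0 {_ ∷ []} _ sh d c = from (contains-maxSplit⇔ (tailPattern 0) sh) (there (here (contains-[] _ , c)))
  contains-tailPattern 0 {_ ∷ _ ∷ []} _ sh d c =
    from (contains-maxSplit⇔ (tailPattern 0) sh)
      (there (there (there (here (decreasing-contains-decreasing d (from-yes (decreasing? (5 ∷ 4 ∷ []))) ≤-refl , c)))))
  contains-tailPattern 0 {_ ∷ _ ∷ _ ∷ _} _ sh d c =
    from (contains-maxSplit⇔ (tailPattern 0) sh)
      (there (there (there (there (here (decreasing-contains-decreasing d (from-yes (decreasing? (5 ∷ 4 ∷ 3 ∷ []))) (s≤s (s≤s (s≤s z≤n))) , c))))))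
  contains-tailPattern 1 {[]} _ sh d c = from (contains-maxSplit⇔ (tailPattern 1) sh) (there (here (contains-[] _ , c)))
  contains-tailPattern 1 {_ ∷ []} _ sh d c = from (contains-maxSplit⇔ (tailPattern 1) sh) (there (here (contains-[] _ , c)))
  contains-tailPattern 1 {_ ∷ _ ∷ _} _ sh d c =
    from (contains-maxSplit⇔ (tailPattern 1) sh)
      (there (there (there (here (decreasing-contains-decreasing d (from-yes (decreasing? (4 ∷ 3 ∷ []))) (s≤s (s≤s z≤n)) , c)))))
  contains-tailPattern 2 _ sh d c = from (contains-maxSplit⇔ (tailPattern 2) sh) (there (here (contains-[] _ , c)))
  contains-tailPattern (suc (suc (suc _))) (s≤s (s≤s ()))

  avoids-tailPattern : ∀ t {α M β} → t ≤ 2 → MaxSplit α M β → Decreasing α →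
    ¬ β contains tailPattern (nextLevel t (length α)) → ¬ (α ++ M ∷ β) contains tailPattern t
  avoids-tailPattern 0 {α} _ sh d k c with to (contains-maxSplit⇔ (tailPattern 0) sh) c
  ... | here (_ , cb) = k (tailPattern-mono z≤n cb)
  ... | there (here (_ , cb)) = k (tailPattern-mono (≤-nextLevel 0 (length α) (s≤s z≤n) (s≤s z≤n)) cb)
  ... | there (there (here (_ , cb))) = k (tailPattern-mono (≤-nextLevel 0 (length α) (s≤s z≤n) (s≤s z≤n)) cb)
  ... | there (there (there (here (ca , cb)))) =
    k (tailPattern-mono (≤-nextLevel 0 (length α) (s≤s (s≤s z≤n)) (s≤s (pred-mono-≤ (contains-length ca)))) cb)
  ... | there (there (there (there (here (ca , cb))))) =
    k (tailPattern-mono (≤-nextLevel 0 (length α) ≤-refl (s≤s (pred-mono-≤ (contains-length ca)))) cb)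
  ... | there (there (there (there (there (here (ca , _)))))) = decreasing-contains d ca
  avoids-tailPattern 1 {α} _ sh d k c with to (contains-maxSplit⇔ (tailPattern 1) sh) c
  ... | here (_ , cb) = k (tailPattern-mono (≤-nextLevel 1 (length α) (s≤s z≤n) (s≤s z≤n)) cb)
  ... | there (here (_ , cb)) = k (tailPattern-mono (≤-nextLevel 1 (length α) (s≤s (s≤s z≤n)) (s≤s (s≤s z≤n))) cb)
  ... | there (there (here (_ , cb))) = k (tailPattern-mono (≤-nextLevel 1 (length α) (s≤s (s≤s z≤n)) (s≤s (s≤s z≤n))) cb)
  ... | there (there (there (here (ca , cb)))) =
    k (tailPattern-mono (≤-nextLevel 1 (length α) ≤-refl (s≤s (s≤s (pred-mono-≤ (contains-length ca))))) cb)
  ... | there (there (there (there (here (ca , _))))) = decreasing-contains d ca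
  avoids-tailPattern 2 {α} _ sh d k c with to (contains-maxSplit⇔ (tailPattern 2) sh) c
  ... | here (_ , cb) = k (tailPattern-mono (≤-nextLevel 2 (length α) (s≤s (s≤s z≤n)) (s≤s (s≤s z≤n))) cb)
  ... | there (here (_ , cb)) = k cb
  ... | there (there (here (_ , cb))) = k cb
  ... | there (there (there (here (ca , _)))) = decreasing-contains d ca
  avoids-tailPattern (suc (suc (suc _))) (s≤s (s≤s ()))

  avoids-tailPattern-[] : ∀ t {α M} → t ≤ 2 → MaxSplit α M [] → ¬ α contains tailPattern t →
    ¬ (α ++ M ∷ []) contains tailPattern t
  avoids-tailPattern-[] 0 _ sh a c with to (contains-maxSplit⇔ (tailPattern 0) sh) c
  ... | here (_ , cb) = ¬[]-contains-∷ cb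
  ... | there (here (_ , cb)) = ¬[]-contains-∷ cb
  ... | there (there (here (_ , cb))) = ¬[]-contains-∷ cb
  ... | there (there (there (here (_ , cb)))) = ¬[]-contains-∷ cb
  ... | there (there (there (there (here (_ , cb))))) = ¬[]-contains-∷ cb
  ... | there (there (there (there (there (here (ca , _)))))) = a ca
  avoids-tailPattern-[] 1 _ sh a c with to (contains-maxSplit⇔ (tailPattern 1) sh) c
  ... | here (_ , cb) = ¬[]-contains-∷ cb
  ... | there (here (_ , cb)) = ¬[]-contains-∷ cb
  ... | there (there (here (_ , cb))) = ¬[]-contains-∷ cb
  ... | there (there (there (here (_ , cb)))) = ¬[]-contains-∷ cb
  ... | there (there (there (there (here (ca , _))))) = a ca
  avoids-tailPattern-[] 2 _ sh a c with to (contains-maxSplit⇔ (tailPattern 2) sh) c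
  ... | here (_ , cb) = ¬[]-contains-∷ cb
  ... | there (here (_ , cb)) = ¬[]-contains-∷ cb
  ... | there (there (here (_ , cb))) = ¬[]-contains-∷ cb
  ... | there (there (there (here (ca , _)))) = a ca
  avoids-tailPattern-[] (suc (suc (suc _))) (s≤s (s≤s ()))

  SplitCondition : ℕ → List ℕ → List ℕ → Set
  SplitCondition t α β =
    (β ≡ [] × Avoider t α) ⊎ (β ≢ [] × Decreasing α × Avoider (nextLevel t (length α)) β)

  SplitCondition₃ : List ℕ → List ℕ → Set
  SplitCondition₃ α β = (β ≡ [] × Increasing α) ⊎ (β ≢ [] × length α ≤ 1 × Avoider 3 β)

  Avoider⇒SplitCondition : ∀ t {α M β} → t ≤ 2 → Unique α → MaxSplit α M β →
    Avoider t (α ++ M ∷ β) → SplitCondition t α β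
  Avoider⇒SplitCondition t {β = []} _ _ sh (k₁ , k₂ , k₃) =
    inj₁ (refl , k₁ ∘ contains-left sh , k₂ ∘ contains-left sh , k₃ ∘ contains-left sh)
  Avoider⇒SplitCondition t {β = _ ∷ _} t≤2 u sh (k₁ , k₂ , k₃) =
    inj₂ ((λ ()) , d , k₁ ∘ contains-right sh , k₂ ∘ contains-right sh , k₃ ∘ contains-tailPattern t t≤2 sh d)
    where
    d = avoids-01⇒Decreasing u (λ c → k₂ (contains2341 sh c contains-singleton))

  SplitCondition⇒Avoider : ∀ t {α M β} → t ≤ 2 → MaxSplit α M β → SplitCondition t α β →
    Avoider t (α ++ M ∷ β)
  SplitCondition⇒Avoider t t≤2 sh (inj₁ (refl , a₁ , a₂ , a₃)) =
    avoids132 sh a₁ ¬[]-contains-∷ ,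
    avoids2341 sh a₂ ¬[]-contains-∷ (¬[]-contains-∷ ∘ proj₂) ,
    avoids-tailPattern-[] t t≤2 sh a₃
  SplitCondition⇒Avoider t t≤2 sh (inj₂ (_ , d , k₁ , k₂ , k₃)) =
    avoids132 sh (decreasing-contains d) k₁ ,
    avoids2341 sh (decreasing-contains d) k₂ (decreasing-contains d ∘ proj₁) ,
    avoids-tailPattern t t≤2 sh d k₃

  short-avoids : ∀ {α σ x y} → length α ≤ 1 → ¬ α contains (x ∷ y ∷ σ)
  short-avoids h c with ≤-trans (contains-length c) h
  ... | s≤s ()

  Avoider₃⇒short : ∀ {α M y β} → Unique α → MaxSplit α M (y ∷ β) → Avoider 3 (α ++ M ∷ y ∷ β) → length α ≤ 1
  Avoider₃⇒short {[]} _ _ _ = z≤n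
  Avoider₃⇒short {_ ∷ []} _ _ _ = s≤s z≤n
  Avoider₃⇒short {x ∷ z ∷ _} ((x≢z ∷ _) ∷ _) sh (_ , k₂ , k₃) with <-cmp x z
  ... | tri< x<z _ _ = ⊥-elim (k₂ (contains2341 sh (contains-01 (here refl) x<z) contains-singleton))
  ... | tri≈ _ x≡z _ = ⊥-elim (x≢z x≡z)
  ... | tri> _ _ z<x =
    ⊥-elim (k₃ (from (contains-maxSplit⇔ (tailPattern 3) sh) (there (here (contains-10 (here refl) z<x , contains-[] _)))))

  Avoider⇒SplitCondition₃ : ∀ {α M β} → Unique α → MaxSplit α M β → Avoider 3 (α ++ M ∷ β) → SplitCondition₃ α β
  Avoider⇒SplitCondition₃ {β = []} u sh (_ , _ , k₃) =
    inj₁ (refl , avoids-10⇒Increasing u (λ c →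
      k₃ (from (contains-maxSplit⇔ (tailPattern 3) sh) (there (here (c , contains-[] []))))))
  Avoider⇒SplitCondition₃ {β = _ ∷ _} u sh k@(k₁ , k₂ , k₃) =
    inj₂ ((λ ()) , Avoider₃⇒short u sh k , k₁ ∘ contains-right sh , k₂ ∘ contains-right sh , k₃ ∘ contains-right sh)

  SplitCondition₃⇒Avoider : ∀ {α M β} → MaxSplit α M β → SplitCondition₃ α β → Avoider 3 (α ++ M ∷ β)
  SplitCondition₃⇒Avoider sh (inj₁ (refl , inc)) =
    avoids132 sh (increasing-contains inc) ¬[]-contains-∷ ,
    avoids2341 sh (increasing-contains inc) ¬[]-contains-∷ (¬[]-contains-∷ ∘ proj₂) ,
    avoids213
    where
    avoids213 : ¬ _ contains tailPattern 3
    avoids213 c with to (contains-maxSplit⇔ (tailPattern 3) sh) c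
    ... | here (_ , cb) = ¬[]-contains-∷ cb
    ... | there (here (ca , _)) = increasing-contains inc ca
    ... | there (there (here (ca , _))) = increasing-contains inc ca
  SplitCondition₃⇒Avoider sh (inj₂ (_ , h , k₁ , k₂ , k₃)) =
    avoids132 sh (short-avoids h) k₁ ,
    avoids2341 sh (short-avoids h) k₂ (short-avoids h ∘ proj₁) ,
    avoids213
    where
    avoids213 : ¬ _ contains tailPattern 3
    avoids213 c with to (contains-maxSplit⇔ (tailPattern 3) sh) c
    ... | here (_ , cb) = k₃ cb
    ... | there (here (ca , _)) = short-avoids h ca
    ... | there (there (here (ca , _))) = short-avoids h ca

module Permutations where
  open import Data.Nat using (ℕ; zero; suc; _+_; _∸_; _<_; _≤_; _≟_; _<?_; _≤?_; z≤n; s≤s)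
  open import Data.Nat.Properties
  open import Data.List using (List; []; _∷_; _++_; length)
  open import Data.List.Properties using (length-++)
  open import Data.List.Relation.Binary.Pointwise using ([]; _∷_)
  open import Data.List.Relation.Binary.Sublist.Propositional {A = ℕ} using (_∷_; from∈)
  open import Data.List.Relation.Binary.Sublist.Propositional.Properties using (++⁺)
  open import Data.List.Relation.Unary.All as All using (All; []; _∷_)
  import Data.List.Relation.Unary.All.Properties as AllP
  open import Data.List.Relation.Unary.AllPairs as AllPairs using ([]; _∷_)
  open import Data.List.Relation.Unary.Unique.Propositional using (Unique)
  import Data.List.Relation.Unary.Unique.Propositional.Properties as UniqueP
  open import Data.List.Relation.Unary.Any using (here; there)
  open import Data.List.Membership.Propositional using (_∈_)
  open import Data.List.Membership.Propositional.Properties using (∈-∃++; ∈-++⁺ˡ; ∈-++⁺ʳ; ∈-++⁻)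
  open import Data.List.Membership.DecPropositional _≟_ using (_∈?_)
  open import Data.Product using (∃-syntax; _×_; _,_; proj₁; proj₂)
  open import Data.Sum using (inj₁; inj₂)
  open import Data.Empty using (⊥; ⊥-elim)
  open import Relation.Binary.Definitions using (tri<; tri≈; tri>)
  open import Relation.Binary.PropositionalEquality using (_≡_; _≢_; refl; sym; trans; subst; subst₂; cong; cong₂)
  open import Relation.Nullary using (¬_; yes; no)
  open Patterns
  open MaxSplit using (Above; MaxSplit)
  open Monotone using (Decreasing; Increasing)
  open Avoidance using (pattern132)

  Perm : ℕ → List ℕ → Set
  Perm n xs = Unique xs × All (_< n) xs × length xs ≡ n

  ascending : ℕ → ℕ → List ℕ
  ascending a zero = []
  ascending a (suc k) = a ∷ ascending (suc a) k

  descending : ℕ → ℕ → List ℕ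
  descending a zero = []
  descending a (suc k) = a + k ∷ descending a k

  Unique-++⁻ : ∀ {A : Set} (a : List A) {b} → Unique (a ++ b) → Unique a × Unique b × (∀ {x} → x ∈ a → x ∈ b → ⊥)
  Unique-++⁻ [] u = [] , u , λ ()
  Unique-++⁻ (y ∷ a) {b} (y∉ ∷ u) with Unique-++⁻ a u
  ... | ua , ub , disj =
    All.tabulate (λ x∈a → All.lookup y∉ (∈-++⁺ˡ x∈a)) ∷ ua , ub ,
    λ { (here refl) x∈b → All.lookup y∉ (∈-++⁺ʳ a x∈b) refl ; (there x∈a) x∈b → disj x∈a x∈b }

  Unique-++⁺ : ∀ {A : Set} {a b : List A} → Unique a → Unique b → (∀ {x} → x ∈ a → x ∈ b → ⊥) → Unique (a ++ b)
  Unique-++⁺ ua ub disj = UniqueP.++⁺ ua ub (λ (p , q) → disj p q)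

  ∈-remove : ∀ {z y : ℕ} xa xb → z ∈ xa ++ y ∷ xb → z ≢ y → z ∈ xa ++ xb
  ∈-remove xa xb z∈ z≢y with ∈-++⁻ xa z∈
  ... | inj₁ p = ∈-++⁺ˡ p
  ... | inj₂ (here refl) = ⊥-elim (z≢y refl)
  ... | inj₂ (there p) = ∈-++⁺ʳ xa p

  Unique-length-≤ : ∀ {ys} (xs : List ℕ) → Unique ys → (∀ {z} → z ∈ ys → z ∈ xs) → length ys ≤ length xs
  Unique-length-≤ {[]} xs u f = z≤n
  Unique-length-≤ {y ∷ ys} xs (y∉ ∷ u) f with ∈-∃++ (f (here refl))
  ... | xa , xb , refl =
    subst (suc (length ys) ≤_) (sym (trans (length-++ xa) (trans (+-suc (length xa) (length xb)) (cong suc (sym (length-++ xa))))))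
      (s≤s (Unique-length-≤ (xa ++ xb) u (λ z∈ys → ∈-remove xa xb (f (there z∈ys)) (λ e → All.lookup y∉ z∈ys (sym e)))))

  length-ascending : ∀ a k → length (ascending a k) ≡ k
  length-ascending a zero = refl
  length-ascending a (suc k) = cong suc (length-ascending (suc a) k)

  length-descending : ∀ a k → length (descending a k) ≡ k
  length-descending a zero = refl
  length-descending a (suc k) = cong suc (length-descending a k)

  ∈-ascending⁺ : ∀ {z} a k → a ≤ z → z < a + k → z ∈ ascending a k
  ∈-ascending⁺ {z} a zero a≤z z<a = ⊥-elim (<-irrefl refl (<-≤-trans (subst (z <_) (+-identityʳ a) z<a) a≤z))
  ∈-ascending⁺ {z} a (suc k) a≤z z< with m≤n⇒m<n∨m≡n a≤z
  ... | inj₂ refl = here refl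
  ... | inj₁ a<z = there (∈-ascending⁺ (suc a) k a<z (subst (z <_) (+-suc a k) z<))

  ∈-ascending⁻ : ∀ {z} a k → z ∈ ascending a k → a ≤ z × z < a + k
  ∈-ascending⁻ a (suc k) (here refl) = ≤-refl , subst (a <_) (sym (+-suc a k)) (s≤s (m≤m+n a k))
  ∈-ascending⁻ {z} a (suc k) (there z∈) with ∈-ascending⁻ (suc a) k z∈
  ... | a<z , z< = <⇒≤ a<z , subst (z <_) (sym (+-suc a k)) z<

  ascending-Unique : ∀ a k → Unique (ascending a k)
  ascending-Unique a zero = []
  ascending-Unique a (suc k) =
    All.tabulate (λ z∈ e → <-irrefl e (proj₁ (∈-ascending⁻ (suc a) k z∈))) ∷ ascending-Unique (suc a) k

  Perm-∈ : ∀ {n xs v} → Perm n xs → v < n → v ∈ xs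
  Perm-∈ {n} {xs} {v} (u , xs<n , len) v<n with v ∈? xs
  ... | yes v∈xs = v∈xs
  ... | no v∉xs = ⊥-elim (<-irrefl refl (≤-trans (subst (λ q → suc q ≤ _) len too-long) (≤-reflexive (length-ascending 0 n))))
    where
    too-long : length (v ∷ xs) ≤ length (ascending 0 n)
    too-long = Unique-length-≤ (ascending 0 n) (All.tabulate (λ x∈xs e → v∉xs (subst (_∈ xs) (sym e) x∈xs)) ∷ u)
      (λ { (here refl) → ∈-ascending⁺ 0 n z≤n v<n ; (there x∈xs) → ∈-ascending⁺ 0 n z≤n (All.lookup xs<n x∈xs) })

  Decreasing⇒Unique : ∀ {xs} → Decreasing xs → Unique xs
  Decreasing⇒Unique = AllPairs.map (λ y<x x≡y → <-irrefl (sym x≡y) y<x)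

  Increasing⇒Unique : ∀ {xs} → Increasing xs → Unique xs
  Increasing⇒Unique = AllPairs.map (λ x<y x≡y → <-irrefl x≡y x<y)

  Unique-bounded-length : ∀ {xs lo hi} → Unique xs → All (lo ≤_) xs → All (_< hi) xs → lo ≤ hi → length xs + lo ≤ hi
  Unique-bounded-length {xs} {lo} {hi} u lo≤ <hi lo≤hi = ≤-trans (+-monoˡ-≤ lo bound) (≤-reflexive (m∸n+n≡m lo≤hi))
    where
    bound : length xs ≤ hi ∸ lo
    bound = subst (length xs ≤_) (length-ascending lo (hi ∸ lo))
      (Unique-length-≤ (ascending lo (hi ∸ lo)) u (λ {z} z∈ →
        ∈-ascending⁺ lo (hi ∸ lo) (All.lookup lo≤ z∈) (subst (z <_) (sym (m+[n∸m]≡n lo≤hi)) (All.lookup <hi z∈))))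

  ≡descending : ∀ a k xs → Decreasing xs → All (a ≤_) xs → All (_< a + k) xs → length xs ≡ k → xs ≡ descending a k
  ≡descending a zero [] _ _ _ _ = refl
  ≡descending a (suc k) (x ∷ xs) (x> ∷ d) (a≤x ∷ a≤) (x< ∷ _) len =
    cong₂ _∷_ x≡ (≡descending a k xs d a≤ (subst (λ q → All (_< q) xs) x≡ x>) (suc-injective len))
    where
    room : k + a ≤ x
    room = subst (λ q → q + a ≤ x) (suc-injective len) (Unique-bounded-length (Decreasing⇒Unique d) a≤ x> a≤x)
    x≡ : x ≡ a + k
    x≡ = ≤-antisym (≤-pred (subst (suc x ≤_) (+-suc a k) x<)) (subst (_≤ x) (+-comm k a) room)

  ≡ascending : ∀ a k xs → Increasing xs → All (a ≤_) xs → All (_< a + k) xs → length xs ≡ k → xs ≡ ascending a k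
  ≡ascending a zero [] _ _ _ _ = refl
  ≡ascending a (suc k) (x ∷ xs) (x< ∷ i) (a≤x ∷ _) (x<ak ∷ <ak) len =
    cong₂ _∷_ x≡ (≡ascending (suc a) k xs i (subst (λ q → All (q <_) xs) x≡ x<) (subst (λ q → All (_< q) xs) (+-suc a k) <ak) (suc-injective len))
    where
    room : k + suc x ≤ a + suc k
    room = subst (λ q → q + suc x ≤ a + suc k) (suc-injective len) (Unique-bounded-length (Increasing⇒Unique i) x< <ak x<ak)
    x≡ : x ≡ a
    x≡ = ≤-antisym (+-cancelˡ-≤ k x a (subst (k + x ≤_) (+-comm a k) (≤-pred (subst₂ _≤_ (+-suc k x) (+-suc a k) room)))) a≤x

  downClosed⇒<length : ∀ {b} → Unique b → (∀ {v w} → v ∈ b → w ≤ v → w ∈ b) → All (_< length b) b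
  downClosed⇒<length {b} u closed = All.tabulate bounded
    where
    bounded : ∀ {v} → v ∈ b → v < length b
    bounded {v} v∈b with v <? length b
    ... | yes v<len = v<len
    ... | no v≮len = ⊥-elim (<-irrefl refl (≤-trans too-long (≮⇒≥ v≮len)))
      where
      too-long : suc v ≤ length b
      too-long = subst (_≤ length b) (length-ascending 0 (suc v))
        (Unique-length-≤ b (ascending-Unique 0 (suc v)) (λ w∈ → closed v∈b (≤-pred (proj₂ (∈-ascending⁻ 0 (suc v) w∈)))))

  contains132 : ∀ {x y n α β} → x ∈ α → y ∈ β → x < y → y < n → x < n → (α ++ n ∷ β) contains pattern132
  contains132 x∈α y∈β x<y y<n x<n =
    _ , ++⁺ (from∈ x∈α) (refl ∷ from∈ y∈β) ,
    (SameOrder-above x<n (s≤s z≤n) ∷ SameOrder-above x<y (s≤s z≤n) ∷ []) ∷ (SameOrder-below y<n (s≤s (s≤s z≤n)) ∷ []) ∷ [] ∷ []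

  maxSplit : ∀ n xs → Perm (suc n) xs → ¬ xs contains pattern132 →
    ∃[ α ] ∃[ β ] xs ≡ α ++ n ∷ β × MaxSplit α n β × Unique α × Perm (length β) β ×
      All (length β ≤_) α × length α + length β ≡ n
  maxSplit n xs perm@(u , xs<n , len) av with ∈-∃++ (Perm-∈ perm (≤-refl {suc n}))
  ... | α , β , refl with Unique-++⁻ α u | AllP.++⁻ α xs<n
  ... | uα , (n∉β ∷ uβ) , disj | α≤n , (_ ∷ β≤n) =
    α , β , refl , (α<n , β<n , α>β) , uα , (uβ , downClosed⇒<length uβ closed , refl) , |β|≤α , lengths
    where
    α<n : All (_< n) α
    α<n = All.tabulate (λ z∈ → ≤∧≢⇒< (≤-pred (All.lookup α≤n z∈)) (λ e → disj z∈ (here e)))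
    β<n : All (_< n) β
    β<n = All.tabulate (λ z∈ → ≤∧≢⇒< (≤-pred (All.lookup β≤n z∈)) (λ e → All.lookup n∉β z∈ (sym e)))
    α>β : Above α β
    α>β = All.tabulate (λ x∈ → All.tabulate (λ y∈ → above x∈ y∈))
      where
      above : ∀ {x y} → x ∈ α → y ∈ β → y < x
      above {x} {y} x∈ y∈ with <-cmp x y
      ... | tri< x<y _ _ = ⊥-elim (av (contains132 x∈ y∈ x<y (All.lookup β<n y∈) (All.lookup α<n x∈)))
      ... | tri≈ _ refl _ = ⊥-elim (disj x∈ (there y∈))
      ... | tri> _ _ y<x = y<x
    closed : ∀ {v w} → v ∈ β → w ≤ v → w ∈ β
    closed v∈ w≤v with ∈-++⁻ α (Perm-∈ perm (s≤s (≤-trans w≤v (<⇒≤ (All.lookup β<n v∈)))))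
    ... | inj₁ w∈α = ⊥-elim (<-irrefl refl (<-≤-trans (All.lookup (All.lookup α>β w∈α) v∈) w≤v))
    ... | inj₂ (here refl) = ⊥-elim (<-irrefl refl (≤-<-trans w≤v (All.lookup β<n v∈)))
    ... | inj₂ (there w∈β) = w∈β
    |β|≤α : All (length β ≤_) α
    |β|≤α = All.tabulate bound
      where
      bound : ∀ {z} → z ∈ α → length β ≤ z
      bound {z} z∈ with length β ≤? z
      ... | yes p = p
      ... | no p = ⊥-elim (disj z∈ (there (Perm-∈ (uβ , downClosed⇒<length uβ closed , refl) (≰⇒> p))))
    lengths : length α + length β ≡ n
    lengths = suc-injective (trans (sym (+-suc (length α) (length β))) (trans (sym (length-++ α)) len))

  maxSplit⁺ : ∀ {α β n L} → Unique α → All (L ≤_) α → All (_< n) α → Perm L β → L ≤ n → length α + L ≡ n →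
    Perm (suc n) (α ++ n ∷ β) × MaxSplit α n β
  maxSplit⁺ {α} {β} {n} {L} uα L≤α α<n (uβ , β<L , lenβ) L≤n lengths =
    (Unique-++⁺ uα (All.tabulate (λ z∈ e → <-irrefl (sym e) (All.lookup β<n z∈)) ∷ uβ) disj ,
     AllP.++⁺ (All.map m<n⇒m<1+n α<n) (≤-refl ∷ All.map m<n⇒m<1+n β<n) ,
     trans (length-++ α) (trans (+-suc (length α) (length β)) (cong suc (trans (cong (length α +_) lenβ) lengths)))) ,
    α<n , β<n , All.map (λ L≤x → All.map (λ y<L → <-≤-trans y<L L≤x) β<L) L≤α
    where
    β<n : All (_< n) β
    β<n = All.map (λ y<L → <-≤-trans y<L L≤n) β<L
    disj : ∀ {x} → x ∈ α → x ∈ n ∷ β → ⊥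
    disj x∈ (here refl) = <-irrefl refl (All.lookup α<n x∈)
    disj x∈ (there x∈β) = <-irrefl refl (<-≤-trans (All.lookup β<L x∈β) (All.lookup L≤α x∈))

  descending-≥ : ∀ a k → All (a ≤_) (descending a k)
  descending-≥ a zero = []
  descending-≥ a (suc k) = m≤m+n a k ∷ descending-≥ a k

  descending-< : ∀ a k → All (_< a + k) (descending a k)
  descending-< a zero = []
  descending-< a (suc k) =
    subst (a + k <_) (sym (+-suc a k)) ≤-refl ∷ All.map (λ {x} x< → subst (x <_) (sym (+-suc a k)) (m<n⇒m<1+n x<)) (descending-< a k)

  descending-Decreasing : ∀ a k → Decreasing (descending a k)
  descending-Decreasing a zero = []
  descending-Decreasing a (suc k) = descending-< a k ∷ descending-Decreasing a k

  ascending-≥ : ∀ a k → All (a ≤_) (ascending a k)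
  ascending-≥ a k = All.tabulate (λ z∈ → proj₁ (∈-ascending⁻ a k z∈))

  ascending-< : ∀ a k → All (_< a + k) (ascending a k)
  ascending-< a k = All.tabulate (λ z∈ → proj₂ (∈-ascending⁻ a k z∈))

  ascending-Increasing : ∀ a k → Increasing (ascending a k)
  ascending-Increasing a zero = []
  ascending-Increasing a (suc k) = ascending-≥ (suc a) k ∷ ascending-Increasing (suc a) k

module Enumeration where
  open import Data.Nat using (ℕ; zero; suc; _+_; _∸_; _<_; _≤_; _≟_; z≤n; s≤s)
  open import Data.Nat.Properties
  open import Data.List using (List; []; _∷_; _++_; length; map; concatMap)
  open import Data.List.Properties using (++-cancelˡ; ++-cancelʳ; ∷-injectiveʳ)
  open import Data.List.Relation.Unary.All as All using (All; []; _∷_)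
  open import Data.List.Relation.Unary.Any using (here; there)
  open import Data.List.Relation.Unary.AllPairs using ([]; _∷_)
  open import Data.List.Relation.Unary.Unique.Propositional using (Unique)
  import Data.List.Relation.Unary.Unique.Propositional.Properties as UniqueP
  open import Data.List.Membership.Propositional using (_∈_; find; lose)
  open import Data.List.Membership.Propositional.Properties using (∈-map⁺; ∈-map⁻; ∈-concatMap⁺; ∈-concatMap⁻)
  open import Data.Product using (_×_; _,_; proj₁; proj₂)
  open import Data.Sum using (inj₁; inj₂)
  open import Data.Empty using (⊥; ⊥-elim)
  open import Relation.Binary.PropositionalEquality using (_≡_; _≢_; refl; sym; trans; subst; cong)
  open import Relation.Nullary using (yes; no)
  open import Function using (_∘_)
  open MaxSplit using (MaxSplit)
  open Avoidance
  open Permutations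

  Generator : Set
  Generator = ℕ → ℕ → List (List ℕ)

  -- The level-t avoiders of size n + 1 (t ≤ 2) whose maximum n is at position k, where l = n ∸ k;
  -- g t m is assumed to list the level-t avoiders of size m.
  blockLow : Generator → ℕ → ℕ → ℕ → ℕ → List (List ℕ)
  blockLow g t n k zero = map (_++ n ∷ []) (g t n)
  blockLow g t n k (suc l) = map (λ β → descending (suc l) k ++ n ∷ β) (g (nextLevel t k) (suc l))

  blockHigh : Generator → ℕ → ℕ → ℕ → List (List ℕ)
  blockHigh g n k zero = (ascending 0 n ++ n ∷ []) ∷ []
  blockHigh g n 0 (suc l) = map (λ β → n ∷ β) (g 3 (suc l))
  blockHigh g n 1 (suc l) = map (λ β → descending (suc l) 1 ++ n ∷ β) (g 3 (suc l))
  blockHigh g n (suc (suc _)) (suc l) = []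

  block : Generator → ℕ → ℕ → ℕ → List (List ℕ)
  block g 0 n k = blockLow g 0 n k (n ∸ k)
  block g 1 n k = blockLow g 1 n k (n ∸ k)
  block g 2 n k = blockLow g 2 n k (n ∸ k)
  block g (suc (suc (suc _))) n k = blockHigh g n k (n ∸ k)

  generate : ℕ → Generator
  generate _ t zero = [] ∷ []
  generate zero t (suc n) = []
  generate (suc fuel) t (suc n) = concatMap (block (generate fuel) t n) (ascending 0 (suc n))

  Correct : Generator → ℕ → Set
  Correct g N = ∀ t m → m ≤ N →
    Unique (g t m) × (∀ {xs} → xs ∈ g t m → Perm m xs × Avoider t xs) × (∀ {xs} → Perm m xs → Avoider t xs → xs ∈ g t m)

  +≡⇒∸≡ : ∀ {k l n} → k + l ≡ n → n ∸ k ≡ l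
  +≡⇒∸≡ {k} {l} refl = m+n∸m≡n k l

  ∸≡⇒+≡ : ∀ {n k l} → k ≤ n → n ∸ k ≡ l → k + l ≡ n
  ∸≡⇒+≡ k≤n refl = m+[n∸m]≡n k≤n

  Perm-nonEmpty : ∀ {β l} → Perm (suc l) β → β ≢ []
  Perm-nonEmpty (_ , _ , ()) refl

  lastMax : ∀ {n α} → Perm n α → Perm (suc n) (α ++ n ∷ []) × MaxSplit α n []
  lastMax (uα , α<n , lenα) = maxSplit⁺ uα (All.tabulate (λ _ → z≤n)) α<n ([] , [] , refl) z≤n (trans (+-identityʳ _) lenα)

  descending-<max : ∀ {n k l} → k ≤ n → n ∸ k ≡ suc l → All (_< n) (descending (suc l) k)
  descending-<max {n} {k} {l} k≤n e =
    All.map (λ x< → <-≤-trans x< (≤-reflexive (trans (+-comm (suc l) k) (∸≡⇒+≡ k≤n e)))) (descending-< (suc l) k)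

  descendingMax : ∀ {n k l β} → k ≤ n → n ∸ k ≡ suc l → Perm (suc l) β →
    Perm (suc n) (descending (suc l) k ++ n ∷ β) × MaxSplit (descending (suc l) k) n β
  descendingMax {n} {k} {l} k≤n e permβ =
    maxSplit⁺ (Decreasing⇒Unique (descending-Decreasing (suc l) k)) (descending-≥ (suc l) k) (descending-<max k≤n e)
      permβ (subst (_≤ n) e (m∸n≤m n k)) (trans (cong (_+ suc l) (length-descending (suc l) k)) (∸≡⇒+≡ k≤n e))

  positionOf : ℕ → List ℕ → ℕ
  positionOf n [] = 0
  positionOf n (x ∷ xs) with x ≟ n
  ... | yes _ = 0
  ... | no _ = suc (positionOf n xs)

  positionOf-++ : ∀ n α β → All (_< n) α → positionOf n (α ++ n ∷ β) ≡ length α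
  positionOf-++ n [] β _ with n ≟ n
  ... | yes _ = refl
  ... | no n≢n = ⊥-elim (n≢n refl)
  positionOf-++ n (x ∷ α) β (x<n ∷ α<n) with x ≟ n
  ... | yes refl = ⊥-elim (<-irrefl refl x<n)
  ... | no _ = cong suc (positionOf-++ n α β α<n)

  MaxAt : ℕ → ℕ → List (List ℕ) → Set
  MaxAt n k L = ∀ {xs} → xs ∈ L → positionOf n xs ≡ k

  concatMap-Unique : ∀ {n} (f : ℕ → List (List ℕ)) ks → Unique ks → (∀ {k} → k ∈ ks → Unique (f k)) →
    (∀ {k} → k ∈ ks → MaxAt n k (f k)) → Unique (concatMap f ks)
  concatMap-Unique f [] _ _ _ = []
  concatMap-Unique {n} f (k ∷ ks) (k∉ ∷ u) uf at =
    Unique-++⁺ (uf (here refl)) (concatMap-Unique f ks u (uf ∘ there) (at ∘ there)) disj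
    where
    disj : ∀ {x} → x ∈ f k → x ∈ concatMap f ks → ⊥
    disj x∈ x∈′ with find (∈-concatMap⁻ f {xs = ks} x∈′)
    ... | k′ , k′∈ , x∈″ = All.lookup k∉ k′∈ (trans (sym (at (here refl) x∈)) (at (there k′∈) x∈″))

  module Blocks {g : Generator} {n : ℕ} (correct : Correct g n) where

    private
      sound : ∀ {t m xs} → m ≤ n → xs ∈ g t m → Perm m xs × Avoider t xs
      sound m≤n = proj₁ (proj₂ (correct _ _ m≤n))

      complete : ∀ {t m xs} → m ≤ n → Perm m xs → Avoider t xs → xs ∈ g t m
      complete m≤n = proj₂ (proj₂ (correct _ _ m≤n))

      unique : ∀ {t m} → m ≤ n → Unique (g t m)
      unique m≤n = proj₁ (correct _ _ m≤n)

      ∸≤ : ∀ {k l} → n ∸ k ≡ l → l ≤ n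
      ∸≤ {k} e = subst (_≤ n) e (m∸n≤m n k)

    blockLow-sound : ∀ {t k l xs} → t ≤ 2 → k ≤ n → n ∸ k ≡ l → xs ∈ blockLow g t n k l →
      Perm (suc n) xs × Avoider t xs
    blockLow-sound {t} {k} {zero} t≤2 _ _ x∈ with ∈-map⁻ (_++ n ∷ []) x∈
    ... | α , α∈ , refl with sound ≤-refl α∈
    ... | permα , avα with lastMax permα
    ... | perm , sh = perm , SplitCondition⇒Avoider t t≤2 sh (inj₁ (refl , avα))
    blockLow-sound {t} {k} {suc l} t≤2 k≤n e x∈ with ∈-map⁻ (λ β → descending (suc l) k ++ n ∷ β) x∈
    ... | β , β∈ , refl with sound (∸≤ {k} e) β∈
    ... | permβ , avβ with descendingMax k≤n e permβ
    ... | perm , sh =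
      perm , SplitCondition⇒Avoider t t≤2 sh (inj₂ (Perm-nonEmpty permβ , descending-Decreasing (suc l) k ,
        subst (λ q → Avoider (nextLevel t q) β) (sym (length-descending (suc l) k)) avβ))

    blockHigh-sound : ∀ {k l xs} → k ≤ n → n ∸ k ≡ l → xs ∈ blockHigh g n k l → Perm (suc n) xs × Avoider 3 xs
    blockHigh-sound {k} {zero} _ _ (here refl) with lastMax (ascending-Unique 0 n , ascending-< 0 n , length-ascending 0 n)
    ... | perm , sh = perm , SplitCondition₃⇒Avoider sh (inj₁ (refl , ascending-Increasing 0 n))
    blockHigh-sound {0} {suc l} k≤n e x∈ with ∈-map⁻ (λ β → n ∷ β) x∈
    ... | β , β∈ , refl with sound (∸≤ {0} e) β∈
    ... | permβ , avβ with descendingMax k≤n e permβ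
    ... | perm , sh = perm , SplitCondition₃⇒Avoider sh (inj₂ (Perm-nonEmpty permβ , z≤n , avβ))
    blockHigh-sound {1} {suc l} k≤n e x∈ with ∈-map⁻ (λ β → descending (suc l) 1 ++ n ∷ β) x∈
    ... | β , β∈ , refl with sound (∸≤ {1} e) β∈
    ... | permβ , avβ with descendingMax k≤n e permβ
    ... | perm , sh = perm , SplitCondition₃⇒Avoider sh (inj₂ (Perm-nonEmpty permβ , s≤s z≤n , avβ))

    block-sound : ∀ t {k xs} → k ≤ n → xs ∈ block g t n k → Perm (suc n) xs × Avoider t xs
    block-sound 0 k≤n = blockLow-sound z≤n k≤n refl
    block-sound 1 k≤n = blockLow-sound (s≤s z≤n) k≤n refl
    block-sound 2 k≤n = blockLow-sound (s≤s (s≤s z≤n)) k≤n refl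
    block-sound (suc (suc (suc t))) k≤n = blockHigh-sound k≤n refl

    blockLow-complete : ∀ {t α β} → Unique α → MaxSplit α n β → Perm (length β) β → All (length β ≤_) α →
      length α + length β ≡ n → SplitCondition t α β → α ++ n ∷ β ∈ blockLow g t n (length α) (n ∸ length α)
    blockLow-complete {t} {α} {[]} uα sh _ _ lengths (inj₁ (refl , avα)) =
      subst (λ q → α ++ n ∷ [] ∈ blockLow g t n (length α) q) (sym (+≡⇒∸≡ {length α} {0} lengths))
        (∈-map⁺ (_++ n ∷ []) (complete ≤-refl (uα , proj₁ sh , trans (sym (+-identityʳ _)) lengths) avα))
    blockLow-complete {t} {α} {y ∷ β} uα sh permβ |β|≤α lengths (inj₂ (_ , d , avβ)) =
      subst (λ q → α ++ n ∷ y ∷ β ∈ blockLow g t n k q) (sym (+≡⇒∸≡ {k} {L} lengths))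
        (subst (λ a → a ++ n ∷ y ∷ β ∈ map (λ β → descending L k ++ n ∷ β) (g (nextLevel t k) L)) (sym α≡)
          (∈-map⁺ (λ β → descending L k ++ n ∷ β) (complete L≤n permβ avβ)))
      where
      k = length α
      L = suc (length β)
      L≤n : L ≤ n
      L≤n = subst (L ≤_) lengths (m≤n+m L k)
      α≡ : α ≡ descending L k
      α≡ = ≡descending L k α d |β|≤α (All.map (λ {z} z< → subst (z <_) (trans (sym lengths) (+-comm k L)) z<) (proj₁ sh)) refl
    blockLow-complete {β = []} _ _ _ _ _ (inj₂ (β≢[] , _)) = ⊥-elim (β≢[] refl)
    blockLow-complete {β = _ ∷ _} _ _ _ _ _ (inj₁ (() , _))

    blockHigh-complete : ∀ {α β} → MaxSplit α n β → Perm (length β) β → All (length β ≤_) α →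
      length α + length β ≡ n → SplitCondition₃ α β → α ++ n ∷ β ∈ blockHigh g n (length α) (n ∸ length α)
    blockHigh-complete {α} {[]} sh _ _ lengths (inj₁ (refl , inc)) =
      subst (λ q → α ++ n ∷ [] ∈ blockHigh g n (length α) q) (sym (+≡⇒∸≡ {length α} {0} lengths))
        (here (cong (_++ n ∷ []) (≡ascending 0 n α inc (All.tabulate (λ _ → z≤n)) (proj₁ sh) (trans (sym (+-identityʳ _)) lengths))))
    blockHigh-complete {[]} {y ∷ β} sh permβ _ lengths (inj₂ (_ , _ , avβ)) =
      subst (λ q → n ∷ y ∷ β ∈ blockHigh g n 0 q) (sym (+≡⇒∸≡ {0} {L} lengths))
        (∈-map⁺ (λ β → n ∷ β) (complete (subst (L ≤_) lengths ≤-refl) permβ avβ))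
      where
      L = suc (length β)
    blockHigh-complete {x ∷ []} {y ∷ β} sh permβ |β|≤α lengths (inj₂ (_ , _ , avβ)) =
      subst (λ q → x ∷ n ∷ y ∷ β ∈ blockHigh g n 1 q) (sym (+≡⇒∸≡ {1} {L} lengths))
        (subst (λ a → a ++ n ∷ y ∷ β ∈ map (λ β → descending L 1 ++ n ∷ β) (g 3 L)) (sym α≡)
          (∈-map⁺ (λ β → descending L 1 ++ n ∷ β) (complete (subst (L ≤_) lengths (m≤n+m L 1)) permβ avβ)))
      where
      L = suc (length β)
      α≡ : x ∷ [] ≡ descending L 1
      α≡ = ≡descending L 1 (x ∷ []) ([] ∷ []) |β|≤α (All.map (λ {z} z< → subst (z <_) (trans (sym lengths) (+-comm 1 L)) z<) (proj₁ sh)) refl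
    blockHigh-complete {_ ∷ _ ∷ _} {_ ∷ _} _ _ _ _ (inj₂ (_ , s≤s () , _))
    blockHigh-complete {β = []} _ _ _ _ (inj₂ (β≢[] , _)) = ⊥-elim (β≢[] refl)
    blockHigh-complete {β = _ ∷ _} _ _ _ _ (inj₁ (() , _))

    block-complete : ∀ t {α β} → Unique α → MaxSplit α n β → Perm (length β) β → All (length β ≤_) α →
      length α + length β ≡ n → Avoider t (α ++ n ∷ β) → α ++ n ∷ β ∈ block g t n (length α)
    block-complete 0 uα sh = λ p b l av → blockLow-complete uα sh p b l (Avoider⇒SplitCondition 0 z≤n uα sh av)
    block-complete 1 uα sh = λ p b l av → blockLow-complete uα sh p b l (Avoider⇒SplitCondition 1 (s≤s z≤n) uα sh av)
    block-complete 2 uα sh = λ p b l av → blockLow-complete uα sh p b l (Avoider⇒SplitCondition 2 (s≤s (s≤s z≤n)) uα sh av)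
    block-complete (suc (suc (suc t))) uα sh = λ p b l av → blockHigh-complete sh p b l (Avoider⇒SplitCondition₃ uα sh av)

    blockLow-maxAt : ∀ {t k l} → k ≤ n → n ∸ k ≡ l → MaxAt n k (blockLow g t n k l)
    blockLow-maxAt {t} {k} {zero} k≤n e x∈ with ∈-map⁻ (_++ n ∷ []) x∈
    ... | α , α∈ , refl with sound ≤-refl α∈
    ... | (_ , α<n , lenα) , _ = trans (positionOf-++ n α [] α<n) (trans lenα (≤-antisym (m∸n≡0⇒m≤n e) k≤n))
    blockLow-maxAt {t} {k} {suc l} k≤n e x∈ with ∈-map⁻ (λ β → descending (suc l) k ++ n ∷ β) x∈
    ... | β , _ , refl = trans (positionOf-++ n (descending (suc l) k) β (descending-<max k≤n e)) (length-descending (suc l) k)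

    blockHigh-maxAt : ∀ {k l} → k ≤ n → n ∸ k ≡ l → MaxAt n k (blockHigh g n k l)
    blockHigh-maxAt {k} {zero} k≤n e (here refl) =
      trans (positionOf-++ n (ascending 0 n) [] (ascending-< 0 n)) (trans (length-ascending 0 n) (≤-antisym (m∸n≡0⇒m≤n e) k≤n))
    blockHigh-maxAt {0} {suc l} k≤n e x∈ with ∈-map⁻ (λ β → n ∷ β) x∈
    ... | β , _ , refl = positionOf-++ n [] β []
    blockHigh-maxAt {1} {suc l} k≤n e x∈ with ∈-map⁻ (λ β → descending (suc l) 1 ++ n ∷ β) x∈
    ... | β , _ , refl = positionOf-++ n (descending (suc l) 1) β (descending-<max k≤n e)

    block-maxAt : ∀ t {k} → k ≤ n → MaxAt n k (block g t n k)
    block-maxAt 0 k≤n = blockLow-maxAt k≤n refl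
    block-maxAt 1 k≤n = blockLow-maxAt k≤n refl
    block-maxAt 2 k≤n = blockLow-maxAt k≤n refl
    block-maxAt (suc (suc (suc t))) k≤n = blockHigh-maxAt k≤n refl

    blockLow-unique : ∀ {t k l} → n ∸ k ≡ l → Unique (blockLow g t n k l)
    blockLow-unique {t} {k} {zero} e = UniqueP.map⁺ (λ {a} {b} eq → ++-cancelʳ (n ∷ []) a b eq) (unique ≤-refl)
    blockLow-unique {t} {k} {suc l} e =
      UniqueP.map⁺ (λ {a} {b} eq → ∷-injectiveʳ (++-cancelˡ (descending (suc l) k) (n ∷ a) (n ∷ b) eq)) (unique (∸≤ {k} e))

    blockHigh-unique : ∀ {k l} → n ∸ k ≡ l → Unique (blockHigh g n k l)
    blockHigh-unique {k} {zero} e = [] ∷ []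
    blockHigh-unique {0} {suc l} e = UniqueP.map⁺ ∷-injectiveʳ (unique (∸≤ {0} e))
    blockHigh-unique {1} {suc l} e = UniqueP.map⁺ (λ eq → ∷-injectiveʳ (∷-injectiveʳ eq)) (unique (∸≤ {1} e))
    blockHigh-unique {suc (suc k)} {suc l} e = []

    block-unique : ∀ t k → Unique (block g t n k)
    block-unique 0 k = blockLow-unique {0} {k} refl
    block-unique 1 k = blockLow-unique {1} {k} refl
    block-unique 2 k = blockLow-unique {2} {k} refl
    block-unique (suc (suc (suc t))) k = blockHigh-unique {k} refl

    private
      position : ∀ {k} → k ∈ ascending 0 (suc n) → k ≤ n
      position k∈ = ≤-pred (proj₂ (∈-ascending⁻ 0 (suc n) k∈))

    step-unique : ∀ t → Unique (concatMap (block g t n) (ascending 0 (suc n)))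
    step-unique t = concatMap-Unique (block g t n) (ascending 0 (suc n)) (ascending-Unique 0 (suc n))
      (λ {k} _ → block-unique t k) (block-maxAt t ∘ position)

    step-sound : ∀ t {xs} → xs ∈ concatMap (block g t n) (ascending 0 (suc n)) → Perm (suc n) xs × Avoider t xs
    step-sound t x∈ with find (∈-concatMap⁻ (block g t n) {xs = ascending 0 (suc n)} x∈)
    ... | k , k∈ , x∈′ = block-sound t (position k∈) x∈′

    step-complete : ∀ t {xs} → Perm (suc n) xs → Avoider t xs → xs ∈ concatMap (block g t n) (ascending 0 (suc n))
    step-complete t {xs} perm av with maxSplit n xs perm (proj₁ av)
    ... | α , β , refl , sh , uα , permβ , |β|≤α , lengths =
      ∈-concatMap⁺ (block g t n)
        (lose (∈-ascending⁺ 0 (suc n) z≤n (s≤s (subst (length α ≤_) lengths (m≤m+n _ _))))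
              (block-complete t uα sh permβ |β|≤α lengths av))

  Perm-[] : ∀ {xs} → Perm 0 xs → xs ≡ []
  Perm-[] {[]} _ = refl

  generate-correct : ∀ fuel → Correct (generate fuel) fuel
  generate-correct fuel t zero _ =
    [] ∷ [] , (λ { (here refl) → ([] , [] , refl) , Avoider-[] t }) , λ perm _ → here (Perm-[] perm)
  generate-correct (suc fuel) t (suc n) (s≤s n≤fuel) = step-unique t , step-sound t , step-complete t
    where open Blocks (λ t′ m m≤n → generate-correct fuel t′ m (≤-trans m≤n n≤fuel))

  avoiders : ℕ → ℕ → List (List ℕ)
  avoiders t n = generate n t n

  avoiders-correct : ∀ t n → Unique (avoiders t n) × (∀ {xs} → xs ∈ avoiders t n → Perm n xs × Avoider t xs) ×
    (∀ {xs} → Perm n xs → Avoider t xs → xs ∈ avoiders t n)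
  avoiders-correct t n = generate-correct n t n ≤-refl

module Counting where
  open import Data.Nat using (ℕ; zero; suc; _+_; _∸_; _≤_; z≤n; s≤s)
  open import Data.Nat.Properties
  open import Data.List using (List; []; _∷_; _++_; length; map; concat; concatMap)
  open import Data.List.Properties using (length-++; length-map; map-cong; map-++)
  open import Data.Nat.ListAction using (sum)
  open import Data.Nat.ListAction.Properties using (sum-++)
  open import Relation.Binary.PropositionalEquality using (_≡_; refl; sym; trans; subst; cong; cong₂; module ≡-Reasoning)
  open import Function using (_∘_)
  open Avoidance using (nextLevel)
  open Permutations using (ascending)
  open Enumeration

  blockLow-cong : ∀ {g g′ : Generator} {t n k l} → (∀ t m → m ≤ n → g t m ≡ g′ t m) → l ≤ n →
    blockLow g t n k l ≡ blockLow g′ t n k l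
  blockLow-cong {l = zero} e _ = cong (map _) (e _ _ ≤-refl)
  blockLow-cong {l = suc l} e l≤n = cong (map _) (e _ _ l≤n)

  blockHigh-cong : ∀ {g g′ : Generator} {n} k l → (∀ t m → m ≤ n → g t m ≡ g′ t m) → l ≤ n →
    blockHigh g n k l ≡ blockHigh g′ n k l
  blockHigh-cong k zero e _ = refl
  blockHigh-cong 0 (suc l) e l≤n = cong (map _) (e 3 _ l≤n)
  blockHigh-cong 1 (suc l) e l≤n = cong (map _) (e 3 _ l≤n)
  blockHigh-cong (suc (suc k)) (suc l) e _ = refl

  block-cong : ∀ t {g g′ : Generator} {n} k → (∀ t m → m ≤ n → g t m ≡ g′ t m) → block g t n k ≡ block g′ t n k
  block-cong 0 {n = n} k e = blockLow-cong e (m∸n≤m n k)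
  block-cong 1 {n = n} k e = blockLow-cong e (m∸n≤m n k)
  block-cong 2 {n = n} k e = blockLow-cong e (m∸n≤m n k)
  block-cong (suc (suc (suc t))) {n = n} k e = blockHigh-cong k (n ∸ k) e (m∸n≤m n k)

  generate-irrelevant : ∀ f f′ t m → m ≤ f → m ≤ f′ → generate f t m ≡ generate f′ t m
  generate-irrelevant f f′ t zero _ _ = refl
  generate-irrelevant (suc f) (suc f′) t (suc n) (s≤s n≤f) (s≤s n≤f′) =
    cong concat (map-cong (λ k → block-cong t k λ t′ m m≤n →
      generate-irrelevant f f′ t′ m (≤-trans m≤n n≤f) (≤-trans m≤n n≤f′)) (ascending 0 (suc n)))

  count : ℕ → ℕ → ℕ
  count t n = length (avoiders t n)

  length-concatMap : ∀ {A B : Set} (f : A → List B) xs → length (concatMap f xs) ≡ sum (map (λ x → length (f x)) xs)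
  length-concatMap f [] = refl
  length-concatMap f (x ∷ xs) = trans (length-++ (f x)) (cong (length (f x) +_) (length-concatMap f xs))

  count-suc : ∀ t n → count t (suc n) ≡ sum (map (λ k → length (block (generate n) t n k)) (ascending 0 (suc n)))
  count-suc t n = length-concatMap (block (generate n) t n) (ascending 0 (suc n))

  length-blockLow-suc : ∀ t n k l → suc l ≤ n → length (blockLow (generate n) t n k (suc l)) ≡ count (nextLevel t k) (suc l)
  length-blockLow-suc t n k l l<n =
    trans (length-map _ (generate n (nextLevel t k) (suc l))) (cong length (generate-irrelevant n (suc l) _ (suc l) l<n ≤-refl))

  length-blockHigh-suc : ∀ n k l → k ≤ 1 → suc l ≤ n → length (blockHigh (generate n) n k (suc l)) ≡ count 3 (suc l)
  length-blockHigh-suc n 0 l _ l<n = trans (length-map _ (generate n 3 (suc l))) (cong length (generate-irrelevant n (suc l) 3 (suc l) l<n ≤-refl))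
  length-blockHigh-suc n 1 l _ l<n = trans (length-map _ (generate n 3 (suc l))) (cong length (generate-irrelevant n (suc l) 3 (suc l) l<n ≤-refl))
  length-blockHigh-suc n (suc (suc _)) l (s≤s ()) _

  total₃ : ℕ → ℕ
  total₃ zero = 0
  total₃ (suc m) = count 3 (suc m) + total₃ m

  ascending-snoc : ∀ a m → ascending a (suc m) ≡ ascending a m ++ a + m ∷ []
  ascending-snoc a zero = cong (_∷ []) (sym (+-identityʳ a))
  ascending-snoc a (suc m) = cong (a ∷_) (trans (ascending-snoc (suc a) m) (cong (λ q → ascending (suc a) m ++ q ∷ []) (sym (+-suc a m))))

  sum-ascending-suc : ∀ (f : ℕ → ℕ) n → sum (map f (ascending 0 (suc n))) ≡ sum (map f (ascending 0 n)) + f n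
  sum-ascending-suc f n = begin
    sum (map f (ascending 0 (suc n)))             ≡⟨ cong (sum ∘ map f) (ascending-snoc 0 n) ⟩
    sum (map f (ascending 0 n ++ n ∷ []))         ≡⟨ cong sum (map-++ f (ascending 0 n) (n ∷ [])) ⟩
    sum (map f (ascending 0 n) ++ f n ∷ [])       ≡⟨ sum-++ (map f (ascending 0 n)) (f n ∷ []) ⟩
    sum (map f (ascending 0 n)) + (f n + 0)       ≡⟨ cong (sum (map f (ascending 0 n)) +_) (+-identityʳ (f n)) ⟩
    sum (map f (ascending 0 n)) + f n             ∎
    where open ≡-Reasoning

  lowBlocks-sum : ∀ t N a m → a + m ≡ N → (∀ k → a ≤ k → nextLevel t k ≡ 3) →
    sum (map (λ k → length (blockLow (generate N) t N k (N ∸ k))) (ascending a m)) ≡ total₃ m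
  lowBlocks-sum t N a zero _ _ = refl
  lowBlocks-sum t N a (suc m) e level≡3 =
    cong₂ _+_ first (lowBlocks-sum t N (suc a) m (trans (sym (+-suc a m)) e) (λ k a<k → level≡3 k (<⇒≤ a<k)))
    where
    first : length (blockLow (generate N) t N a (N ∸ a)) ≡ count 3 (suc m)
    first rewrite +≡⇒∸≡ {a} {suc m} e =
      trans (length-blockLow-suc t N a m (subst (suc m ≤_) e (m≤n+m (suc m) a))) (cong (λ q → count q (suc m)) (level≡3 a ≤-refl))

  highBlocks-sum : ∀ N a m → 2 ≤ a → a + m ≡ N →
    sum (map (λ k → length (blockHigh (generate N) N k (N ∸ k))) (ascending a (suc m))) ≡ 1
  highBlocks-sum N (suc zero) _ (s≤s ()) _
  highBlocks-sum N (suc (suc a)) zero _ e rewrite +≡⇒∸≡ {suc (suc a)} {0} e = refl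
  highBlocks-sum N (suc (suc a)) (suc m) _ e rewrite +≡⇒∸≡ {suc (suc a)} {suc m} e =
    highBlocks-sum N (suc (suc (suc a))) m (s≤s (s≤s z≤n)) (trans (sym (+-suc (suc (suc a)) m)) e)

  lastBlock : ∀ t n → length (blockLow (generate n) t n n (n ∸ n)) ≡ count t n
  lastBlock t n rewrite n∸n≡0 n = length-map _ (generate n t n)

  count₃-rec : ∀ m → count 3 (3 + m) ≡ count 3 (2 + m) + (count 3 (1 + m) + 1)
  count₃-rec m = begin
    count 3 (3 + m)                                   ≡⟨ count-suc 3 (2 + m) ⟩
    f 0 + (f 1 + sum (map f (ascending 2 (suc m))))   ≡⟨ cong₂ _+_ (length-blockHigh-suc (2 + m) 0 (1 + m) z≤n ≤-refl)
                                                           (cong₂ _+_ (length-blockHigh-suc (2 + m) 1 m (s≤s z≤n) (n≤1+n _))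
                                                                      (highBlocks-sum (2 + m) 2 m (s≤s (s≤s z≤n)) refl)) ⟩
    count 3 (2 + m) + (count 3 (1 + m) + 1)           ∎
    where
    open ≡-Reasoning
    f = λ k → length (blockHigh (generate (2 + m)) (2 + m) k ((2 + m) ∸ k))

  count₂-rec : ∀ n → count 2 (suc n) ≡ total₃ n + count 2 n
  count₂-rec n = begin
    count 2 (suc n)                                   ≡⟨ count-suc 2 n ⟩
    sum (map f (ascending 0 (suc n)))                 ≡⟨ sum-ascending-suc f n ⟩
    sum (map f (ascending 0 n)) + f n                 ≡⟨ cong₂ _+_ (lowBlocks-sum 2 n 0 n refl (λ _ _ → refl)) (lastBlock 2 n) ⟩
    total₃ n + count 2 n                              ∎
    where
    open ≡-Reasoning
    f = λ k → length (blockLow (generate n) 2 n k (n ∸ k))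

  count₁-rec : ∀ m → count 1 (3 + m) ≡ count 2 (2 + m) + (count 2 (1 + m) + total₃ m) + count 1 (2 + m)
  count₁-rec m = begin
    count 1 (3 + m)                                   ≡⟨ count-suc 1 (2 + m) ⟩
    sum (map f (ascending 0 (3 + m)))                 ≡⟨ sum-ascending-suc f (2 + m) ⟩
    f 0 + (f 1 + sum (map f (ascending 2 m))) + f (2 + m)
      ≡⟨ cong₂ _+_ (cong₂ _+_ (length-blockLow-suc 1 (2 + m) 0 (1 + m) ≤-refl)
                              (cong₂ _+_ (length-blockLow-suc 1 (2 + m) 1 m (n≤1+n _))
                                         (lowBlocks-sum 1 (2 + m) 2 m refl level≡3)))
                   (lastBlock 1 (2 + m)) ⟩
    count 2 (2 + m) + (count 2 (1 + m) + total₃ m) + count 1 (2 + m) ∎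
    where
    open ≡-Reasoning
    f = λ k → length (blockLow (generate (2 + m)) 1 (2 + m) k ((2 + m) ∸ k))
    level≡3 : ∀ k → 2 ≤ k → nextLevel 1 k ≡ 3
    level≡3 (suc zero) (s≤s ())
    level≡3 (suc (suc k)) _ = refl

  count₀-rec : ∀ m → count 0 (4 + m) ≡ count 1 (3 + m) + (count 1 (2 + m) + (count 2 (1 + m) + total₃ m)) + count 0 (3 + m)
  count₀-rec m = begin
    count 0 (4 + m)                                   ≡⟨ count-suc 0 (3 + m) ⟩
    sum (map f (ascending 0 (4 + m)))                 ≡⟨ sum-ascending-suc f (3 + m) ⟩
    f 0 + (f 1 + (f 2 + sum (map f (ascending 3 m)))) + f (3 + m)
      ≡⟨ cong₂ _+_ (cong₂ _+_ (length-blockLow-suc 0 (3 + m) 0 (2 + m) ≤-refl)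
                              (cong₂ _+_ (length-blockLow-suc 0 (3 + m) 1 (1 + m) (n≤1+n _))
                                         (cong₂ _+_ (length-blockLow-suc 0 (3 + m) 2 m (≤-trans (n≤1+n _) (n≤1+n _)))
                                                    (lowBlocks-sum 0 (3 + m) 3 m refl level≡3))))
                   (lastBlock 0 (3 + m)) ⟩
    count 1 (3 + m) + (count 1 (2 + m) + (count 2 (1 + m) + total₃ m)) + count 0 (3 + m) ∎
    where
    open ≡-Reasoning
    f = λ k → length (blockLow (generate (3 + m)) 0 (3 + m) k ((3 + m) ∸ k))
    level≡3 : ∀ k → 3 ≤ k → nextLevel 0 k ≡ 3
    level≡3 (suc zero) (s≤s ())
    level≡3 (suc (suc zero)) (s≤s (s≤s ()))
    level≡3 (suc (suc (suc k))) _ = refl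

module ClosedForm where
  open import Data.Nat as ℕ using (ℕ; zero; suc; _!)
  open import Data.Nat.Properties using (+-comm)
  open import Data.Fin using (zero; suc)
  import Data.Fin as Fin
  open import Function using (_∘_)
  open import Data.Integer using (ℤ; +_; _+_; _-_; _*_)
  open import Data.Integer.Properties using (*-cancelˡ-≡; *-distribˡ-+; *-zeroˡ; *-zeroʳ; pos-+; pos-*)
  open import Data.Nat.Combinatorics using (_C_; nC1≡n; nCk+nC[k+1]≡[n+1]C[k+1])
  open import Data.Integer.Tactic.RingSolver using (ring; solve-∀)
  open import Tactic.RingSolver.NonReflective ring using (solve; _⊜_; Expr; Κ; Ι; _⊕_; _⊗_; ⊝_; module Ops)
  open import Data.Vec using ([]; _∷_)
  open import Data.Product using (_×_; _,_; proj₁)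
  open import Relation.Binary.PropositionalEquality using (_≡_; refl; sym; trans; cong; cong₂; module ≡-Reasoning)
  open import Defs using (F; formula)
  open Counting
  open Ops using (⟦_⟧)

  -- Closed forms are built as polynomial expressions so that identities between them can be
  -- checked by the ring solver; they are evaluated at the atoms (F (m + 1), F m, m).
  Poly : ℕ → Set
  Poly = Expr ℤ

  infixl 6 _⊖_
  _⊖_ : ∀ {k} → Poly k → Poly k → Poly k
  x ⊖ y = x ⊕ ⊝ y

  # : ∀ {k} → ℕ → Poly k
  # c = Κ (+ c)

  Atomsᴾ : ℕ → Set
  Atomsᴾ k = Poly k × Poly k × Poly k

  shiftᴾ : ∀ {k} → Atomsᴾ k → Atomsᴾ k
  shiftᴾ (a , b , n) = a ⊕ b , a , # 1 ⊕ n

  shiftByᴾ : ∀ {k} → ℕ → Atomsᴾ k → Atomsᴾ k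
  shiftByᴾ zero p = p
  shiftByᴾ (suc j) p = shiftᴾ (shiftByᴾ j p)

  -- fibAt j evaluates to F (m + j + 1) at the atoms of m.
  fibAt : ∀ {k} → ℕ → Atomsᴾ k → Poly k
  fibAt j p = proj₁ (shiftByᴾ j p)

  closed₃ᴾ : ∀ {k} → Atomsᴾ k → Poly k
  closed₃ᴾ p = fibAt 2 p ⊖ # 1

  closedₜᴾ : ∀ {k} → Atomsᴾ k → Poly k
  closedₜᴾ p@(_ , _ , n) = fibAt 3 p ⊖ # 3 ⊖ n

  closed₂ᴾ : ∀ {k} → Atomsᴾ k → Poly k
  closed₂ᴾ p@(_ , _ , n) = # 2 ⊗ fibAt 4 p ⊖ # 4 ⊖ # 4 ⊗ (n ⊕ # 1) ⊖ n ⊗ (n ⊕ # 1)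

  closed₁ᴾ : ∀ {k} → Atomsᴾ k → Poly k
  closed₁ᴾ p@(_ , _ , n) =
    # 18 ⊗ fibAt 6 p ⊖ # 84 ⊖ # 18 ⊗ (n ⊕ # 3) ⊖ # 12 ⊗ ((n ⊕ # 3) ⊗ (n ⊕ # 2)) ⊖ # 2 ⊗ ((n ⊕ # 3) ⊗ (n ⊕ # 2) ⊗ (n ⊕ # 1))

  poly₀ᴾ : ∀ {k} → Poly k → Poly k
  poly₀ᴾ n =
    # 4 ⊗ ((n ⊕ # 3) ⊗ (n ⊕ # 2) ⊗ (n ⊕ # 1) ⊗ n) ⊕ # 28 ⊗ ((n ⊕ # 3) ⊗ (n ⊕ # 2) ⊗ (n ⊕ # 1)) ⊕ # 60 ⊗ ((n ⊕ # 3) ⊗ (n ⊕ # 2))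
      ⊕ # 648 ⊗ (n ⊕ # 3) ⊕ # 192

  closed₀ᴾ : ∀ {k} → Atomsᴾ k → Poly k
  closed₀ᴾ p@(_ , _ , n) = # 24 ⊗ (# 5 ⊗ fibAt 7 p ⊕ fibAt 5 p) ⊖ poly₀ᴾ n

  Atoms : Set
  Atoms = ℤ × ℤ × ℤ

  atomsAt : ℕ → Atoms
  atomsAt m = + F (suc m) , + F m , + m

  shift : Atoms → Atoms
  shift (a , b , n) = a + b , a , + 1 + n

  evaluate : (∀ {k} → Atomsᴾ k → Poly k) → Atoms → ℤ
  evaluate Q (a , b , n) = ⟦ Q (Ι zero , Ι (suc zero) , Ι (suc (suc zero))) ⟧ (a ∷ b ∷ n ∷ [])

  closed₃ closedₜ closed₂ closed₁ closed₀ : Atoms → ℤ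
  closed₃ = evaluate closed₃ᴾ
  closedₜ = evaluate closedₜᴾ
  closed₂ = evaluate closed₂ᴾ
  closed₁ = evaluate closed₁ᴾ
  closed₀ = evaluate closed₀ᴾ

  poly₀ : ℤ → ℤ
  poly₀ n = ⟦ poly₀ᴾ (Ι zero) ⟧ (n ∷ [])

  closed₃-step : ∀ a b n → let p = (a , b , n) in closed₃ (shift (shift p)) ≡ closed₃ (shift p) + (closed₃ p + + 1)
  closed₃-step = solve 3 (λ a b n → let p = (a , b , n) in
    closed₃ᴾ (shiftᴾ (shiftᴾ p)) ⊜ (closed₃ᴾ (shiftᴾ p) ⊕ (closed₃ᴾ p ⊕ # 1))) refl

  closedₜ-step : ∀ a b n → let p = (a , b , n) in closedₜ (shift p) ≡ closed₃ p + closedₜ p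
  closedₜ-step = solve 3 (λ a b n → let p = (a , b , n) in closedₜᴾ (shiftᴾ p) ⊜ (closed₃ᴾ p ⊕ closedₜᴾ p)) refl

  closed₂-step : ∀ a b n → let p = (a , b , n) in closed₂ (shift p) ≡ + 2 * closedₜ p + closed₂ p
  closed₂-step = solve 3 (λ a b n → let p = (a , b , n) in closed₂ᴾ (shiftᴾ p) ⊜ (# 2 ⊗ closedₜᴾ p ⊕ closed₂ᴾ p)) refl

  closed₁-step : ∀ a b n → let p = (a , b , n) in
    closed₁ (shift p) ≡ + 3 * closed₂ (shift (shift p)) + (+ 3 * closed₂ (shift p) + + 6 * closedₜ p) + closed₁ p
  closed₁-step = solve 3 (λ a b n → let p = (a , b , n) in
    closed₁ᴾ (shiftᴾ p) ⊜ (# 3 ⊗ closed₂ᴾ (shiftᴾ (shiftᴾ p)) ⊕ (# 3 ⊗ closed₂ᴾ (shiftᴾ p) ⊕ # 6 ⊗ closedₜᴾ p) ⊕ closed₁ᴾ p)) refl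

  closed₀-step : ∀ a b n → let p = (a , b , n) in
    closed₀ (shift (shift p)) ≡ + 4 * closed₁ (shift p) + (+ 4 * closed₁ p + (+ 12 * closed₂ (shift p) + + 24 * closedₜ p)) + closed₀ (shift p)
  closed₀-step = solve 3 (λ a b n → let p = (a , b , n) in
    closed₀ᴾ (shiftᴾ (shiftᴾ p))
      ⊜ (# 4 ⊗ closed₁ᴾ (shiftᴾ p) ⊕ (# 4 ⊗ closed₁ᴾ p ⊕ (# 12 ⊗ closed₂ᴾ (shiftᴾ p) ⊕ # 24 ⊗ closedₜᴾ p)) ⊕ closed₀ᴾ (shiftᴾ p))) refl

  count₃-closed : ∀ m → + count 3 (suc m) ≡ closed₃ (atomsAt m)
  count₃-closed 0 = refl
  count₃-closed 1 = refl
  count₃-closed (suc (suc m)) = begin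
    + count 3 (3 ℕ.+ m)                           ≡⟨ cong +_ (count₃-rec m) ⟩
    + count 3 (2 ℕ.+ m) + (+ count 3 (1 ℕ.+ m) + + 1)
      ≡⟨ cong₂ (λ x y → x + (y + + 1)) (count₃-closed (suc m)) (count₃-closed m) ⟩
    closed₃ (shift p) + (closed₃ p + + 1)         ≡⟨ closed₃-step (+ F (suc m)) (+ F m) (+ m) ⟨
    closed₃ (shift (shift p))                         ∎
    where
    open ≡-Reasoning
    p = atomsAt m

  total₃-closed : ∀ m → + total₃ m ≡ closedₜ (atomsAt m)
  total₃-closed 0 = refl
  total₃-closed (suc m) =
    trans (cong₂ _+_ (count₃-closed m) (total₃-closed m)) (sym (closedₜ-step (+ F (suc m)) (+ F m) (+ m)))

  count₂-closed : ∀ m → + 2 * + count 2 m ≡ closed₂ (atomsAt m)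
  count₂-closed 0 = refl
  count₂-closed (suc m) = begin
    + 2 * + count 2 (suc m)                       ≡⟨ cong (λ x → + 2 * + x) (count₂-rec m) ⟩
    + 2 * (+ total₃ m + + count 2 m)              ≡⟨ *-distribˡ-+ (+ 2) (+ total₃ m) (+ count 2 m) ⟩
    + 2 * + total₃ m + + 2 * + count 2 m          ≡⟨ cong₂ (λ x y → + 2 * x + y) (total₃-closed m) (count₂-closed m) ⟩
    + 2 * closedₜ p + closed₂ p                   ≡⟨ closed₂-step (+ F (suc m)) (+ F m) (+ m) ⟨
    closed₂ (shift p)                             ∎
    where
    open ≡-Reasoning
    p = atomsAt m

  count₁-closed : ∀ m → + 6 * + count 1 (2 ℕ.+ m) ≡ closed₁ (atomsAt m)
  count₁-closed 0 = refl
  count₁-closed (suc m) = begin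
    + 6 * + count 1 (3 ℕ.+ m)
      ≡⟨ cong (λ x → + 6 * + x) (count₁-rec m) ⟩
    + 6 * (+ count 2 (2 ℕ.+ m) + (+ count 2 (1 ℕ.+ m) + + total₃ m) + + count 1 (2 ℕ.+ m))
      ≡⟨ regroup (+ count 2 (2 ℕ.+ m)) (+ count 2 (1 ℕ.+ m)) (+ total₃ m) (+ count 1 (2 ℕ.+ m)) ⟩
    + 3 * (+ 2 * + count 2 (2 ℕ.+ m)) + (+ 3 * (+ 2 * + count 2 (1 ℕ.+ m)) + + 6 * + total₃ m) + + 6 * + count 1 (2 ℕ.+ m)
      ≡⟨ cong₂ _+_ (cong₂ (λ x y → + 3 * x + y) (count₂-closed (2 ℕ.+ m))
                     (cong₂ (λ y z → + 3 * y + + 6 * z) (count₂-closed (1 ℕ.+ m)) (total₃-closed m)))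
                   (count₁-closed m) ⟩
    + 3 * closed₂ (shift (shift p)) + (+ 3 * closed₂ (shift p) + + 6 * closedₜ p) + closed₁ p
      ≡⟨ closed₁-step (+ F (suc m)) (+ F m) (+ m) ⟨
    closed₁ (shift p) ∎
    where
    open ≡-Reasoning
    p = atomsAt m
    regroup : ∀ x y z w → + 6 * (x + (y + z) + w) ≡ + 3 * (+ 2 * x) + (+ 3 * (+ 2 * y) + + 6 * z) + + 6 * w
    regroup = solve-∀

  count₀-closed : ∀ m → + 24 * + count 0 (2 ℕ.+ m) ≡ closed₀ (atomsAt m)
  count₀-closed 0 = refl
  count₀-closed 1 = refl
  count₀-closed (suc (suc m)) = begin
    + 24 * + count 0 (4 ℕ.+ m)
      ≡⟨ cong (λ x → + 24 * + x) (count₀-rec m) ⟩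
    + 24 * (+ count 1 (3 ℕ.+ m) + (+ count 1 (2 ℕ.+ m) + (+ count 2 (1 ℕ.+ m) + + total₃ m)) + + count 0 (3 ℕ.+ m))
      ≡⟨ regroup (+ count 1 (3 ℕ.+ m)) (+ count 1 (2 ℕ.+ m)) (+ count 2 (1 ℕ.+ m)) (+ total₃ m) (+ count 0 (3 ℕ.+ m)) ⟩
    + 4 * (+ 6 * + count 1 (3 ℕ.+ m)) + (+ 4 * (+ 6 * + count 1 (2 ℕ.+ m)) + (+ 12 * (+ 2 * + count 2 (1 ℕ.+ m)) + + 24 * + total₃ m))
      + + 24 * + count 0 (3 ℕ.+ m)
      ≡⟨ cong₂ _+_ (cong₂ (λ x y → + 4 * x + y) (count₁-closed (suc m))
                     (cong₂ (λ y z → + 4 * y + z) (count₁-closed m)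
                       (cong₂ (λ z w → + 12 * z + + 24 * w) (count₂-closed (1 ℕ.+ m)) (total₃-closed m))))
                   (count₀-closed (suc m)) ⟩
    + 4 * closed₁ (shift p) + (+ 4 * closed₁ p + (+ 12 * closed₂ (shift p) + + 24 * closedₜ p)) + closed₀ (shift p)
      ≡⟨ closed₀-step (+ F (suc m)) (+ F m) (+ m) ⟨
    closed₀ (shift (shift p)) ∎
    where
    open ≡-Reasoning
    p = atomsAt m
    regroup : ∀ x y z w v →
      + 24 * (x + (y + (z + w)) + v) ≡ + 4 * (+ 6 * x) + (+ 4 * (+ 6 * y) + (+ 12 * (+ 2 * z) + + 24 * w)) + + 24 * v
    regroup = solve-∀

  fallingᴾ : ∀ {k} → Poly k → ℕ → Poly k
  fallingᴾ y zero = # 1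
  fallingᴾ y (suc j) = fallingᴾ y j ⊗ (y ⊖ # j)

  falling : ℤ → ℕ → ℤ
  falling y j = ⟦ fallingᴾ (Ι zero) j ⟧ (y ∷ [])

  falling-suc : ∀ y k → falling (+ 1 + y) (suc k) ≡ (+ 1 + y) * falling y k
  falling-suc y zero = one y
    where
    one : ∀ y → + 1 * (+ 1 + y - + 0) ≡ (+ 1 + y) * + 1
    one = solve-∀
  falling-suc y (suc k) = begin
    falling (+ 1 + y) (suc k) * (+ 1 + y - + suc k)   ≡⟨ cong (_* (+ 1 + y - + suc k)) (falling-suc y k) ⟩
    (+ 1 + y) * falling y k * (+ 1 + y - (+ 1 + + k)) ≡⟨ shuffle (falling y k) y (+ k) ⟩
    (+ 1 + y) * (falling y k * (y - + k))             ∎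
    where
    open ≡-Reasoning
    shuffle : ∀ x y k → (+ 1 + y) * x * (+ 1 + y - (+ 1 + k)) ≡ (+ 1 + y) * (x * (y - k))
    shuffle = solve-∀

  falling-zero : ∀ k → falling (+ 0) (suc k) ≡ + 0
  falling-zero zero = refl
  falling-zero (suc k) = trans (cong (_* (+ 0 - + suc k)) (falling-zero k)) (*-zeroˡ (+ 0 - + suc k))

  factorial-choose : ∀ y k → + (k !) * + (y C k) ≡ falling (+ y) k
  factorial-choose y zero = refl
  factorial-choose zero (suc k) = trans (*-zeroʳ (+ (suc k !))) (sym (falling-zero k))
  factorial-choose (suc y) (suc k) = begin
    + (suc k !) * + (suc y C suc k)
      ≡⟨ cong₂ _*_ (pos-* (suc k) (k !)) (trans (cong +_ (sym (nCk+nC[k+1]≡[n+1]C[k+1] y k))) (pos-+ (y C k) (y C suc k))) ⟩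
    + suc k * + (k !) * (+ (y C k) + + (y C suc k))
      ≡⟨ split (+ suc k) (+ (k !)) (+ (y C k)) (+ (y C suc k)) ⟩
    + suc k * (+ (k !) * + (y C k)) + + suc k * + (k !) * + (y C suc k)
      ≡⟨ cong₂ (λ x z → + suc k * x + z) (factorial-choose y k)
           (trans (cong (_* + (y C suc k)) (sym (pos-* (suc k) (k !)))) (factorial-choose y (suc k))) ⟩
    + suc k * falling (+ y) k + falling (+ y) k * (+ y - + k)
      ≡⟨ merge (falling (+ y) k) (+ y) (+ k) ⟩
    (+ 1 + + y) * falling (+ y) k
      ≡⟨ falling-suc (+ y) k ⟨
    falling (+ suc y) (suc k) ∎
    where
    open ≡-Reasoning
    split : ∀ s f c₁ c₂ → s * f * (c₁ + c₂) ≡ s * (f * c₁) + s * f * c₂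
    split = solve-∀
    merge : ∀ x y k → (+ 1 + k) * x + x * (y - k) ≡ (+ 1 + y) * x
    merge = solve-∀

  scaledᴾ : ∀ {k} → Poly k → Poly k → Poly k → Poly k → Poly k → Poly k → Poly k
  scaledᴾ f₈ f₆ d₄ d₃ d₂ y = # 24 ⊗ (# 5 ⊗ f₈ ⊕ f₆) ⊖ # 4 ⊗ d₄ ⊖ # 28 ⊗ d₃ ⊖ # 60 ⊗ d₂ ⊖ # 648 ⊗ y ⊖ # 192

  scaledFormula : ℤ → ℤ → ℤ → ℤ → ℤ → ℤ → ℤ
  scaledFormula f₈ f₆ d₄ d₃ d₂ y =
    ⟦ scaledᴾ (Ι (Fin.# 0)) (Ι (Fin.# 1)) (Ι (Fin.# 2)) (Ι (Fin.# 3)) (Ι (Fin.# 4)) (Ι (Fin.# 5)) ⟧ (f₈ ∷ f₆ ∷ d₄ ∷ d₃ ∷ d₂ ∷ y ∷ [])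

  -- Scaling by 24 = 4! clears the denominators of the binomial coefficients.
  formula-scaled : ∀ n → let y = + (n ℕ.+ 1) in
    + 24 * formula n ≡ scaledFormula (+ F (n ℕ.+ 6)) (+ F (n ℕ.+ 4)) (falling y 4) (falling y 3) (falling y 2) y
  formula-scaled n = begin
    + 24 * formula n
      ≡⟨ cong (+ 24 *_) expand ⟩
    + 24 * (+ 5 * + f₆ + + f₄ - + 4 * + (y C 4) - + 7 * + (y C 3) - + 5 * + (y C 2) - + 27 * + (y C 1) - + 8)
      ≡⟨ regroup (+ f₆) (+ f₄) (+ (y C 4)) (+ (y C 3)) (+ (y C 2)) (+ (y C 1)) ⟩
    scaledFormula (+ f₆) (+ f₄) (+ 24 * + (y C 4)) (+ 6 * + (y C 3)) (+ 2 * + (y C 2)) (+ (y C 1))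
      ≡⟨ cong₂ (λ (d₄ , d₃) (d₂ , c₁) → scaledFormula (+ f₆) (+ f₄) d₄ d₃ d₂ c₁)
           (cong₂ _,_ (factorial-choose y 4) (factorial-choose y 3))
           (cong₂ _,_ (factorial-choose y 2) (cong +_ (nC1≡n y))) ⟩
    scaledFormula (+ f₆) (+ f₄) (falling (+ y) 4) (falling (+ y) 3) (falling (+ y) 2) (+ y) ∎
    where
    open ≡-Reasoning
    f₆ = F (n ℕ.+ 6)
    f₄ = F (n ℕ.+ 4)
    y = n ℕ.+ 1
    expand : formula n ≡ + 5 * + f₆ + + f₄ - + 4 * + (y C 4) - + 7 * + (y C 3) - + 5 * + (y C 2) - + 27 * + (y C 1) - + 8
    expand =
      cong₂ _-_ (cong₂ _-_ (cong₂ _-_ (cong₂ _-_ (cong₂ _-_ (trans (pos-+ (5 ℕ.* f₆) f₄) (cong (_+ + f₄) (pos-* 5 f₆)))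
        (pos-* 4 (y C 4))) (pos-* 7 (y C 3))) (pos-* 5 (y C 2))) (pos-* 27 (y C 1))) refl
    regroup : ∀ f₆ f₄ c₄ c₃ c₂ c₁ →
      + 24 * (+ 5 * f₆ + f₄ - + 4 * c₄ - + 7 * c₃ - + 5 * c₂ - + 27 * c₁ - + 8) ≡
      scaledFormula f₆ f₄ (+ 24 * c₄) (+ 6 * c₃) (+ 2 * c₂) c₁
    regroup = solve 6 (λ f₆ f₄ c₄ c₃ c₂ c₁ →
      # 24 ⊗ (# 5 ⊗ f₆ ⊕ f₄ ⊖ # 4 ⊗ c₄ ⊖ # 7 ⊗ c₃ ⊖ # 5 ⊗ c₂ ⊖ # 27 ⊗ c₁ ⊖ # 8)
        ⊜ scaledᴾ f₆ f₄ (# 24 ⊗ c₄) (# 6 ⊗ c₃) (# 2 ⊗ c₂) c₁) refl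

  fib : ℕ → Atoms → ℤ
  fib j = evaluate (fibAt j)

  scaledFormula-closed₀ : ∀ a b n → let p = (a , b , n) ; y = + 3 + n in
    scaledFormula (fib 7 p) (fib 5 p) (falling y 4) (falling y 3) (falling y 2) y ≡ closed₀ p
  scaledFormula-closed₀ = solve 3 (λ a b n → let p = (a , b , n) ; y = # 3 ⊕ n in
    scaledᴾ (fibAt 7 p) (fibAt 5 p) (fallingᴾ y 4) (fallingᴾ y 3) (fallingᴾ y 2) y ⊜ closed₀ᴾ p) refl

  formula-closed : ∀ m → + 24 * formula (2 ℕ.+ m) ≡ closed₀ (atomsAt m)
  formula-closed m = begin
    + 24 * formula (2 ℕ.+ m)
      ≡⟨ formula-scaled (2 ℕ.+ m) ⟩
    scaledFormula (+ F (2 ℕ.+ m ℕ.+ 6)) (+ F (2 ℕ.+ m ℕ.+ 4)) (falling y 4) (falling y 3) (falling y 2) y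
      ≡⟨ cong₂ (λ (f₈ , f₆) y → scaledFormula f₈ f₆ (falling y 4) (falling y 3) (falling y 2) y)
           (cong₂ _,_ (cong (+_ ∘ F) (+-comm (2 ℕ.+ m) 6)) (cong (+_ ∘ F) (+-comm (2 ℕ.+ m) 4)))
           (cong +_ (+-comm (2 ℕ.+ m) 1)) ⟩
    scaledFormula (fib 7 p) (fib 5 p) (falling (+ 3 + + m) 4) (falling (+ 3 + + m) 3) (falling (+ 3 + + m) 2) (+ 3 + + m)
      ≡⟨ scaledFormula-closed₀ (+ F (suc m)) (+ F m) (+ m) ⟩
    closed₀ p ∎
    where
    open ≡-Reasoning
    p = atomsAt m
    y = + (2 ℕ.+ m ℕ.+ 1)

  count₀≡formula : ∀ m → + count 0 (2 ℕ.+ m) ≡ formula (2 ℕ.+ m)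
  count₀≡formula m = *-cancelˡ-≡ (+ 24) (+ count 0 (2 ℕ.+ m)) (formula (2 ℕ.+ m)) (trans (count₀-closed m) (sym (formula-closed m)))

module GeneratingFunction where
  open import Data.Nat as ℕ using (ℕ; zero; suc; _≤_; _≤?_; _<?_; s≤s)
  open import Data.Nat.Properties using (+-comm; m+n≤o⇒m≤o∸n; ≰⇒>; ≮⇒≥; ≤-trans; ≤-reflexive; ≤-pred; +-monoʳ-≤; m≤m+n; m+[n∸m]≡n)
  open import Data.Integer using (ℤ; +_; _+_; _-_; _*_; -_; _≟_)
  open import Data.Integer.Properties using (*-cancelˡ-≡; *-zeroʳ)
  open import Data.Integer.Tactic.RingSolver using (ring; solve-∀)
  open import Tactic.RingSolver.NonReflective ring using (solve; _⊜_; Κ; Ι; _⊕_; _⊗_; module Ops)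
  open import Data.Fin using (zero; suc)
  open import Data.Vec using ([]; _∷_)
  open Ops using (⟦_⟧)
  open import Data.List using (List; []; _∷_; map; foldr; upTo; applyUpTo; length)
  open import Data.List.Properties using (map-cong)
  open import Data.List.Relation.Unary.All as All using (All; []; _∷_; all?)
  open import Data.List.Relation.Unary.All.Properties using (applyUpTo⁺₂)
  open import Data.List.Membership.Propositional.Properties using (∈-upTo⁺)
  open import Data.Product using (_×_; _,_)
  open import Relation.Binary.PropositionalEquality using (_≡_; refl; trans; subst; cong; cong₂; module ≡-Reasoning)
  open import Relation.Nullary using (yes; no)
  open import Relation.Nullary.Decidable using (from-yes)
  open import Defs using (F; Series; poly; _⋆_; oneMinusX; denominator; numerator; formula)
  open Counting using (count)
  open ClosedForm

  VanishesFrom : Series → ℕ → Set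
  VanishesFrom s d = ∀ i → d ≤ i → s i ≡ + 0

  poly-vanishes : ∀ cs → VanishesFrom (poly cs) (length cs)
  poly-vanishes [] i _ = refl
  poly-vanishes (c ∷ cs) (suc i) (s≤s h) = poly-vanishes cs i h

  sum-zero : ∀ (f : ℕ → ℤ) {xs} → All (λ j → f j ≡ + 0) xs → foldr _+_ (+ 0) (map f xs) ≡ + 0
  sum-zero f [] = refl
  sum-zero f (fx≡0 ∷ fxs≡0) = cong₂ _+_ fx≡0 (sum-zero f fxs≡0)

  ⋆-vanishes : ∀ {A B} α β → VanishesFrom A (suc α) → VanishesFrom B (suc β) → VanishesFrom (A ⋆ B) (suc (α ℕ.+ β))
  ⋆-vanishes {A} {B} α β A₀ B₀ i i> = sum-zero _ (All.universal term (upTo (suc i)))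
    where
    term : ∀ j → A j * B (i ℕ.∸ j) ≡ + 0
    term j with suc α ≤? j
    ... | yes α<j = cong (_* B (i ℕ.∸ j)) (A₀ j α<j)
    ... | no α≮j = trans (cong (A j *_) (B₀ (i ℕ.∸ j) (m+n≤o⇒m≤o∸n (suc β) (≤-trans room i>)))) (*-zeroʳ (A j))
      where
      room : suc β ℕ.+ j ≤ suc (α ℕ.+ β)
      room = ≤-trans (+-monoʳ-≤ (suc β) (≤-pred (≰⇒> α≮j))) (≤-reflexive (cong suc (+-comm β α)))

  oneMinusX-vanishes : VanishesFrom oneMinusX 2
  oneMinusX-vanishes = poly-vanishes (+ 1 ∷ - + 1 ∷ [])

  denominator-vanishes : VanishesFrom denominator 8
  denominator-vanishes =
    ⋆-vanishes 2 5 (poly-vanishes (- + 1 ∷ + 1 ∷ + 1 ∷ []))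
      (⋆-vanishes 1 4 oneMinusX-vanishes (⋆-vanishes 1 3 oneMinusX-vanishes
        (⋆-vanishes 1 2 oneMinusX-vanishes (⋆-vanishes 1 1 oneMinusX-vanishes oneMinusX-vanishes))))

  ⋆-congʳ : ∀ a {b b′ : Series} → (∀ k → b k ≡ b′ k) → ∀ m → (a ⋆ b) m ≡ (a ⋆ b′) m
  ⋆-congʳ a b≡b′ m = cong (foldr _+_ (+ 0)) (map-cong (λ i → cong (a i *_) (b≡b′ (m ℕ.∸ i))) (upTo (suc m)))

  weighted : (ℕ → ℤ) → List (ℤ × ℕ) → ℤ
  weighted s [] = + 0
  weighted s ((c , j) ∷ cjs) = c * s j + weighted s cjs

  weighted-scale : ∀ k s cjs → k * weighted s cjs ≡ weighted (λ j → k * s j) cjs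
  weighted-scale k s [] = *-zeroʳ k
  weighted-scale k s ((c , j) ∷ cjs) =
    trans (distribute k c (s j) (weighted s cjs)) (cong (λ y → c * (k * s j) + y) (weighted-scale k s cjs))
    where
    distribute : ∀ k c x y → k * (c * x + y) ≡ c * (k * x) + k * y
    distribute = solve-∀

  weighted-cong : ∀ {s s′} cjs → (∀ j → s j ≡ s′ j) → weighted s cjs ≡ weighted s′ cjs
  weighted-cong [] _ = refl
  weighted-cong ((c , j) ∷ cjs) s≡s′ = cong₂ (λ x y → c * x + y) (s≡s′ j) (weighted-cong cjs s≡s′)

  -- The coefficients of the denominator, paired with 7 − i.
  annihilator : List (ℤ × ℕ)
  annihilator =
    (- + 1 , 7) ∷ (+ 6 , 6) ∷ (- + 14 , 5) ∷ (+ 15 , 4) ∷ (- + 5 , 3) ∷ (- + 4 , 2) ∷ (+ 4 , 1) ∷ (- + 1 , 0) ∷ []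

  weighted-∸ : ∀ (f g : ℕ → ℤ) cjs → weighted (λ j → f j - g j) cjs ≡ weighted f cjs - weighted g cjs
  weighted-∸ f g [] = refl
  weighted-∸ f g ((c , j) ∷ cjs) =
    trans (cong (λ y → c * (f j - g j) + y) (weighted-∸ f g cjs)) (regroup c (f j) (g j) (weighted f cjs) (weighted g cjs))
    where
    regroup : ∀ c x y u v → c * (x - y) + (u - v) ≡ c * x + u - (c * y + v)
    regroup = solve-∀

  weightedᴾ : ∀ {k} → (ℕ → Poly k) → List (ℤ × ℕ) → Poly k
  weightedᴾ s [] = # 0
  weightedᴾ s ((c , j) ∷ cjs) = Κ c ⊗ s j ⊕ weightedᴾ s cjs

  fibCombinationᴾ : ∀ {k} → ℕ → Poly k → Poly k → Poly k
  fibCombinationᴾ j a b = Κ (+ F (suc j)) ⊗ a ⊕ Κ (+ F j) ⊗ b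

  fibCombination : ℕ → ℤ → ℤ → ℤ
  fibCombination j a b = ⟦ fibCombinationᴾ j (Ι zero) (Ι (suc zero)) ⟧ (a ∷ b ∷ [])

  F-+ : ∀ k m → + F (suc (k ℕ.+ m)) ≡ fibCombination k (+ F (suc m)) (+ F m)
  F-+ zero m = one (+ F (suc m)) (+ F m)
    where
    one : ∀ a b → a ≡ + 1 * a + + 0 * b
    one = solve-∀
  F-+ (suc zero) m = two (+ F (suc m)) (+ F m)
    where
    two : ∀ a b → a + b ≡ + 1 * a + + 1 * b
    two = solve-∀
  F-+ (suc (suc k)) m =
    trans (cong₂ _+_ (F-+ (suc k) m) (F-+ k m)) (step (+ F (suc (suc k))) (+ F (suc k)) (+ F k) (+ F (suc m)) (+ F m))
    where
    step : ∀ f₂ f₁ f₀ a b → f₂ * a + f₁ * b + (f₁ * a + f₀ * b) ≡ (f₂ + f₁) * a + (f₁ + f₀) * b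
    step = solve-∀

  fib-annihilated : ∀ a b →
    weighted (λ j → + 24 * (+ 5 * fibCombination (7 ℕ.+ j) a b + fibCombination (5 ℕ.+ j) a b)) annihilator ≡ + 0
  fib-annihilated = solve 2 (λ a b →
    weightedᴾ (λ j → # 24 ⊗ (# 5 ⊗ fibCombinationᴾ (7 ℕ.+ j) a b ⊕ fibCombinationᴾ (5 ℕ.+ j) a b)) annihilator ⊜ # 0) refl

  poly₀-annihilated : ∀ n → weighted (λ j → poly₀ (+ j + n)) annihilator ≡ + 0
  poly₀-annihilated = solve 1 (λ n → weightedᴾ (λ j → poly₀ᴾ (# j ⊕ n)) annihilator ⊜ # 0) refl

  ⋆-denominator-beyond : ∀ (a : Series) r → (denominator ⋆ a) (9 ℕ.+ r) ≡ weighted (λ j → a (2 ℕ.+ j ℕ.+ r)) annihilator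
  ⋆-denominator-beyond a r = cong (λ t → f 0 + (f 1 + (f 2 + (f 3 + (f 4 + (f 5 + (f 6 + (f 7 + t)))))))) tail
    where
    f : ℕ → ℤ
    f i = denominator i * a (9 ℕ.+ r ℕ.∸ i)
    tail : foldr _+_ (+ 0) (map f (applyUpTo (8 ℕ.+_) (2 ℕ.+ r))) ≡ + 0
    tail = sum-zero f (applyUpTo⁺₂ (8 ℕ.+_) (2 ℕ.+ r) λ i →
      cong (_* a (9 ℕ.+ r ℕ.∸ (8 ℕ.+ i))) (denominator-vanishes (8 ℕ.+ i) (m≤m+n 8 i)))

  gf-beyond : ∀ r → (denominator ⋆ (λ k → + count 0 k)) (9 ℕ.+ r) ≡ + 0
  gf-beyond r = *-cancelˡ-≡ (+ 24) ((denominator ⋆ c₀) (9 ℕ.+ r)) (+ 0) (begin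
    + 24 * (denominator ⋆ c₀) (9 ℕ.+ r)                  ≡⟨ cong (+ 24 *_) (⋆-denominator-beyond c₀ r) ⟩
    + 24 * weighted (λ j → c₀ (2 ℕ.+ j ℕ.+ r)) annihilator ≡⟨ weighted-scale (+ 24) (λ j → c₀ (2 ℕ.+ j ℕ.+ r)) annihilator ⟩
    weighted (λ j → + 24 * c₀ (2 ℕ.+ j ℕ.+ r)) annihilator ≡⟨ weighted-cong annihilator (λ j → count₀-closed (j ℕ.+ r)) ⟩
    weighted (λ j → fibPart j - poly₀ (+ j + + r)) annihilator ≡⟨ weighted-∸ fibPart (λ j → poly₀ (+ j + + r)) annihilator ⟩
    weighted fibPart annihilator - weighted (λ j → poly₀ (+ j + + r)) annihilator
      ≡⟨ cong₂ _-_ (trans (weighted-cong annihilator fibPart-+) (fib-annihilated a b)) (poly₀-annihilated (+ r)) ⟩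
    + 0 - + 0                                            ≡⟨ *-zeroʳ (+ 24) ⟨
    + 24 * + 0                                           ∎)
    where
    open ≡-Reasoning
    c₀ : Series
    c₀ k = + count 0 k
    a = + F (suc r)
    b = + F r
    fibPart : ℕ → ℤ
    fibPart j = + 24 * (+ 5 * + F (8 ℕ.+ (j ℕ.+ r)) + + F (6 ℕ.+ (j ℕ.+ r)))
    fibPart-+ : ∀ j → fibPart j ≡ + 24 * (+ 5 * fibCombination (7 ℕ.+ j) a b + fibCombination (5 ℕ.+ j) a b)
    fibPart-+ j = cong₂ (λ x y → + 24 * (+ 5 * x + y)) (F-+ (7 ℕ.+ j) r) (F-+ (5 ℕ.+ j) r)

  closedSequence : Series
  closedSequence 0 = + 1
  closedSequence 1 = + 1
  closedSequence (suc (suc m)) = formula (2 ℕ.+ m)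

  count₀≡closedSequence : ∀ k → + count 0 k ≡ closedSequence k
  count₀≡closedSequence 0 = refl
  count₀≡closedSequence 1 = refl
  count₀≡closedSequence (suc (suc m)) = count₀≡formula m

  gf-initial : All (λ m → (denominator ⋆ closedSequence) m ≡ numerator m) (upTo 9)
  gf-initial = from-yes (all? (λ m → (denominator ⋆ closedSequence) m ≟ numerator m) (upTo 9))

  generatingFunction : ∀ m → (denominator ⋆ (λ k → + count 0 k)) m ≡ numerator m
  generatingFunction m with m <? 9
  ... | yes m<9 = trans (⋆-congʳ denominator count₀≡closedSequence m) (All.lookup gf-initial (∈-upTo⁺ m<9))
  ... | no m≮9 = subst (λ k → (denominator ⋆ (λ k → + count 0 k)) k ≡ numerator k) (m+[n∸m]≡n (≮⇒≥ m≮9)) (gf-beyond (m ℕ.∸ 9))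

module Bridge where
  open import Data.Nat as ℕ using (ℕ; zero; suc; z≤n; s≤s; _<?_)
  open import Data.Nat.Properties using (<-irrefl; <-trans; ≤-pred)
  open import Data.Fin as Fin using (Fin; zero; suc; toℕ; fromℕ<)
  open import Data.Fin.Properties using (toℕ-injective; toℕ<n; fromℕ<-toℕ; toℕ-fromℕ<)
  open import Data.Vec as Vec using (Vec; lookup)
  open import Data.Vec.Properties using (lookup∘tabulate; tabulate∘lookup)
  import Data.Vec.Properties as Vecₚ
  open import Data.List using (List; []; _∷_; length; map; tabulate)
  open import Data.List.Properties using (length-tabulate; length-map; tabulate-cong)
  open import Data.List.Relation.Binary.Pointwise as Pw using ([]; _∷_)
  open import Data.List.Relation.Binary.Sublist.Propositional {A = ℕ} using (_⊆_; []; _∷_; _∷ʳ_)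
  open import Data.List.Relation.Binary.Sublist.Propositional.Properties using ([]⊆-universal)
  open import Data.List.Relation.Unary.All as All using (All; []; _∷_)
  import Data.List.Relation.Unary.All.Properties as AllP
  open import Data.List.Relation.Unary.Any using (here; there)
  open import Data.List.Relation.Unary.Unique.Propositional using (Unique)
  import Data.List.Relation.Unary.Unique.Propositional.Properties as UniqueP
  open import Data.List.Membership.Propositional using (_∈_)
  open import Data.List.Membership.Propositional.Properties using (∈-map⁺; ∈-map⁻; ∈-tabulate⁻)
  open import Data.Product using (Σ; _×_; _,_; proj₁; proj₂)
  open import Data.Empty using (⊥-elim)
  open import Function using (_∘_; _⇔_; mk⇔; Equivalence)
  open Equivalence using (to; from)
  open import Relation.Binary.PropositionalEquality using (_≡_; refl; sym; trans; subst; subst₂; cong)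
  open import Relation.Nullary using (yes; no)
  import Defs as D
  open import Data.List.Relation.Unary.AllPairs using ([]; _∷_)
  open Patterns
  open Permutations using (Perm; Perm-∈)
  open Avoidance using (Avoider)
  open Enumeration using (avoiders; avoiders-correct)
  open Counting using (count)

  toList : ∀ {n} → Vec (Fin n) n → List ℕ
  toList π = tabulate (λ i → toℕ (lookup π i))

  StrictlyIncreasing : ∀ {m n} → (Fin m → Fin n) → Set
  StrictlyIncreasing {m} ι = ∀ (a b : Fin m) → a Fin.< b → ι a Fin.< ι b

  ⊆-tabulate⁻ : ∀ {n} (f : Fin n → ℕ) {s} → s ⊆ tabulate f →
    Σ (Fin (length s) → Fin n) λ ι → StrictlyIncreasing ι × s ≡ tabulate (f ∘ ι)
  ⊆-tabulate⁻ {zero} f [] = (λ ()) , (λ ()) , refl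
  ⊆-tabulate⁻ {suc n} f (_ ∷ʳ p) with ⊆-tabulate⁻ (f ∘ suc) p
  ... | ι , inc , eq = suc ∘ ι , (λ a b a<b → s≤s (inc a b a<b)) , eq
  ⊆-tabulate⁻ {suc n} f (refl ∷ p) with ⊆-tabulate⁻ (f ∘ suc) p
  ... | ι , inc , eq = ι′ , inc′ , cong (f zero ∷_) eq
    where
    ι′ : Fin (suc _) → Fin (suc n)
    ι′ zero = zero
    ι′ (suc a) = suc (ι a)
    inc′ : StrictlyIncreasing ι′
    inc′ zero (suc b) _ = s≤s z≤n
    inc′ (suc a) (suc b) (s≤s a<b) = s≤s (inc a b a<b)

  lowerFamily : ∀ {m n} (ι : Fin m → Fin (suc n)) → StrictlyIncreasing ι → (∀ a → 0 ℕ.< toℕ (ι a)) →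
    Σ (Fin m → Fin n) λ ι′ → StrictlyIncreasing ι′ × (∀ a → suc (ι′ a) ≡ ι a)
  lowerFamily ι inc pos = ι′ , (λ a b a<b → ≤-pred (subst₂ (λ u v → toℕ u ℕ.< toℕ v) (sym (suc-ι′ a)) (sym (suc-ι′ b)) (inc a b a<b))) , suc-ι′
    where
    predFin : (j : Fin (suc _)) → 0 ℕ.< toℕ j → Fin _
    predFin (suc j) _ = j
    ι′ = λ a → predFin (ι a) (pos a)
    suc-ι′ : ∀ a → suc (ι′ a) ≡ ι a
    suc-ι′ a with ι a | pos a
    ... | suc j | _ = refl

  ⊆-tabulate⁺ : ∀ {n m} (f : Fin n → ℕ) (ι : Fin m → Fin n) → StrictlyIncreasing ι → tabulate (f ∘ ι) ⊆ tabulate f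
  ⊆-tabulate⁺ {n} {zero} f ι inc = []⊆-universal _
  ⊆-tabulate⁺ {zero} {suc m} f ι inc with ι zero
  ... | ()
  ⊆-tabulate⁺ {suc n} {suc m} f ι inc = byFirst (ι zero) refl
    where
    rest : ∀ {k} (ι′ : Fin k → Fin n) → StrictlyIncreasing ι′ → ∀ {ι″ : Fin k → Fin (suc n)} → (∀ a → suc (ι′ a) ≡ ι″ a) →
      tabulate (f ∘ ι″) ⊆ tabulate (f ∘ suc)
    rest ι′ inc′ suc-ι′ = subst (_⊆ tabulate (f ∘ suc)) (tabulate-cong (cong f ∘ suc-ι′)) (⊆-tabulate⁺ (f ∘ suc) ι′ inc′)
    byFirst : ∀ j → ι zero ≡ j → tabulate (f ∘ ι) ⊆ tabulate f
    byFirst zero eq with lowerFamily (ι ∘ suc) (λ a b → inc (suc a) (suc b) ∘ s≤s)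
                          (λ a → subst (λ z → toℕ z ℕ.< toℕ (ι (suc a))) eq (inc zero (suc a) (s≤s z≤n)))
    ... | ι′ , inc′ , suc-ι′ = cong f eq ∷ rest ι′ inc′ suc-ι′
    byFirst (suc j) eq with lowerFamily ι inc positive
      where
      positive : ∀ a → 0 ℕ.< toℕ (ι a)
      positive zero rewrite eq = s≤s z≤n
      positive (suc a) = <-trans (positive zero) (inc zero (suc a) (s≤s z≤n))
    ... | ι′ , inc′ , suc-ι′ = f zero ∷ʳ rest ι′ inc′ suc-ι′

  SameOrderOn : ∀ {m} → (Fin m → ℕ) → (Fin m → ℕ) → Set
  SameOrderOn {m} h g = ∀ (a b : Fin m) → (h a ℕ.< h b → g a ℕ.< g b) × (g a ℕ.< g b → h a ℕ.< h b)

  SameOrderOn⇒OrderIso : ∀ {m} (h g : Fin m → ℕ) → SameOrderOn h g → OrderIso (tabulate h) (tabulate g)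
  SameOrderOn⇒OrderIso {zero} h g o = []
  SameOrderOn⇒OrderIso {suc m} h g o =
    Pw.tabulate⁺ (λ b → ⇔-fromPair (o zero (suc b)) , ⇔-fromPair (o (suc b) zero)) ∷ SameOrderOn⇒OrderIso (h ∘ suc) (g ∘ suc) (λ a b → o (suc a) (suc b))
    where
    ⇔-fromPair : ∀ {A B : Set} → (A → B) × (B → A) → A ⇔ B
    ⇔-fromPair (f , f⁻¹) = mk⇔ f f⁻¹

  OrderIso⇒SameOrderOn : ∀ {m} (h g : Fin m → ℕ) → OrderIso (tabulate h) (tabulate g) → SameOrderOn h g
  OrderIso⇒SameOrderOn {suc m} h g (pw ∷ o) zero zero = (λ h<h → ⊥-elim (<-irrefl refl h<h)) , (λ g<g → ⊥-elim (<-irrefl refl g<g))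
  OrderIso⇒SameOrderOn {suc m} h g (pw ∷ o) zero (suc b) = let (p , _) = Pw.tabulate⁻ pw b in to p , from p
  OrderIso⇒SameOrderOn {suc m} h g (pw ∷ o) (suc a) zero = let (_ , q) = Pw.tabulate⁻ pw a in to q , from q
  OrderIso⇒SameOrderOn {suc m} h g (pw ∷ o) (suc a) (suc b) = OrderIso⇒SameOrderOn (h ∘ suc) (g ∘ suc) o a b

  Contains⇒contains : ∀ {n m} (π : Vec (Fin n) n) (σ : Vec (Fin m) m) → D.Contains π σ → toList π contains toList σ
  Contains⇒contains π σ (ι , inc , ord) =
    tabulate (toℕ ∘ lookup π ∘ ι) , ⊆-tabulate⁺ (toℕ ∘ lookup π) ι inc ,
    SameOrderOn⇒OrderIso (toℕ ∘ lookup π ∘ ι) (toℕ ∘ lookup σ) ord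

  contains⇒Contains : ∀ {n m} (π : Vec (Fin n) n) (σ : Vec (Fin m) m) → toList π contains toList σ → D.Contains π σ
  contains⇒Contains {n} {m} π σ (s , s⊆ , o) with ⊆-tabulate⁻ (toℕ ∘ lookup π) s⊆
  ... | ι , inc , s≡ = reindex ι inc (subst (λ z → OrderIso z (toList σ)) s≡ o)
    where
    reindex : ∀ {k} (ι : Fin k → Fin n) → StrictlyIncreasing ι → OrderIso (tabulate (toℕ ∘ lookup π ∘ ι)) (toList σ) →
      D.Contains π σ
    reindex ι inc o with trans (sym (length-tabulate (toℕ ∘ lookup π ∘ ι))) (trans (OrderIso-length o) (length-tabulate (toℕ ∘ lookup σ)))
    ... | refl = ι , inc , OrderIso⇒SameOrderOn _ _ o

  nth : List ℕ → ℕ → ℕ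
  nth [] _ = 0
  nth (x ∷ xs) zero = x
  nth (x ∷ xs) (suc k) = nth xs k

  nth-tabulate : ∀ {m} (f : Fin m → ℕ) (i : Fin m) → nth (tabulate f) (toℕ i) ≡ f i
  nth-tabulate f zero = refl
  nth-tabulate f (suc i) = nth-tabulate (f ∘ suc) i

  tabulate-nth : ∀ xs → tabulate (λ (i : Fin (length xs)) → nth xs (toℕ i)) ≡ xs
  tabulate-nth [] = refl
  tabulate-nth (x ∷ xs) = cong (x ∷_) (tabulate-nth xs)

  nth-All : ∀ {P : ℕ → Set} {xs k} → All P xs → k ℕ.< length xs → P (nth xs k)
  nth-All {xs = _ ∷ _} {zero} (p ∷ _) _ = p
  nth-All {xs = _ ∷ _} {suc k} (_ ∷ ps) (s≤s k<) = nth-All ps k<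

  -- x as an element of Fin n, or the junk value i when x ≥ n.
  toFinOr : ∀ {n} → Fin n → ℕ → Fin n
  toFinOr {n} i x with x <? n
  ... | yes x<n = fromℕ< x<n
  ... | no _ = i

  toℕ-toFinOr : ∀ {n} (i : Fin n) x → x ℕ.< n → toℕ (toFinOr i x) ≡ x
  toℕ-toFinOr {n} i x x<n with x <? n
  ... | yes x<n′ = toℕ-fromℕ< x<n′
  ... | no x≮n = ⊥-elim (x≮n x<n)

  toFinOr-toℕ : ∀ {n} (i j : Fin n) → toFinOr i (toℕ j) ≡ j
  toFinOr-toℕ {n} i j with toℕ j <? n
  ... | yes j<n = fromℕ<-toℕ j j<n
  ... | no j≮n = ⊥-elim (j≮n (toℕ<n j))

  fromList : (n : ℕ) → List ℕ → Vec (Fin n) n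
  fromList n xs = Vec.tabulate (λ i → toFinOr i (nth xs (toℕ i)))

  toList-fromList : ∀ {n xs} → Perm n xs → toList (fromList n xs) ≡ xs
  toList-fromList {n} {xs} (_ , xs<n , refl) =
    trans (tabulate-cong (λ i → trans (cong toℕ (lookup∘tabulate (λ i → toFinOr i (nth xs (toℕ i))) i))
                                      (toℕ-toFinOr i _ (nth-All xs<n (toℕ<n i)))))
          (tabulate-nth xs)

  fromList-toList : ∀ {n} (π : Vec (Fin n) n) → fromList n (toList π) ≡ π
  fromList-toList π =
    trans (Vecₚ.tabulate-cong (λ i → trans (cong (toFinOr i) (nth-tabulate (toℕ ∘ lookup π) i)) (toFinOr-toℕ i (lookup π i))))
          (tabulate∘lookup π)

  Unique-tabulate⁻ : ∀ {m} (f : Fin m → ℕ) → Unique (tabulate f) → ∀ i j → f i ≡ f j → i ≡ j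
  Unique-tabulate⁻ f (_ ∷ _) zero zero _ = refl
  Unique-tabulate⁻ f (f₀∉ ∷ _) zero (suc j) e = ⊥-elim (AllP.tabulate⁻ f₀∉ j e)
  Unique-tabulate⁻ f (f₀∉ ∷ _) (suc i) zero e = ⊥-elim (AllP.tabulate⁻ f₀∉ i (sym e))
  Unique-tabulate⁻ f (_ ∷ u) (suc i) (suc j) e = cong suc (Unique-tabulate⁻ (f ∘ suc) u i j e)

  IsPerm⇒Perm : ∀ {n} (π : Vec (Fin n) n) → D.IsPerm π → Perm n (toList π)
  IsPerm⇒Perm π (injective , _) =
    UniqueP.tabulate⁺ (λ {i} {j} e → injective i j (toℕ-injective e)) , AllP.tabulate⁺ (λ i → toℕ<n (lookup π i)) , length-tabulate _

  Perm⇒IsPerm : ∀ {n} (π : Vec (Fin n) n) → Perm n (toList π) → D.IsPerm π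
  Perm⇒IsPerm π perm@(u , _ , _) =
    (λ i j e → Unique-tabulate⁻ (toℕ ∘ lookup π) u i j (cong toℕ e)) ,
    (λ k → let (i , e) = ∈-tabulate⁻ (Perm-∈ perm (toℕ<n k)) in i , toℕ-injective (sym e))

  InClass⇒Avoider : ∀ {n} (π : Vec (Fin n) n) → D.InClass π → Perm n (toList π) × Avoider 0 (toList π)
  InClass⇒Avoider π (isPerm , a₁ , a₂ , a₃) =
    IsPerm⇒Perm π isPerm ,
    a₁ ∘ contains⇒Contains π D.p132 , a₃ ∘ contains⇒Contains π D.p2341 , a₂ ∘ contains⇒Contains π D.p654213

  Avoider⇒InClass : ∀ {n} (π : Vec (Fin n) n) → Perm n (toList π) → Avoider 0 (toList π) → D.InClass π
  Avoider⇒InClass π perm (k₁ , k₂ , k₃) =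
    Perm⇒IsPerm π perm ,
    k₁ ∘ Contains⇒contains π D.p132 , k₃ ∘ Contains⇒contains π D.p654213 , k₂ ∘ Contains⇒contains π D.p2341

  Unique-map-leftInverse : ∀ {A B : Set} (f : A → B) (g : B → A) {xs} → Unique xs →
    (∀ {x} → x ∈ xs → g (f x) ≡ x) → Unique (map f xs)
  Unique-map-leftInverse f g [] _ = []
  Unique-map-leftInverse f g {x ∷ xs} (x∉ ∷ u) inv =
    AllP.map⁺ (All.tabulate (λ {y} y∈ fx≡fy → All.lookup x∉ y∈ (trans (sym (inv (here refl))) (trans (cong g fx≡fy) (inv (there y∈)))))) ∷
    Unique-map-leftInverse f g u (inv ∘ there)

  classCard : ∀ n → D.ClassCard n (count 0 n)
  classCard n = map (fromList n) (avoiders 0 n) , unique′ , length-map (fromList n) (avoiders 0 n) , λ π → sound′ π , complete′ π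
    where
    unique : Unique (avoiders 0 n)
    unique = proj₁ (avoiders-correct 0 n)
    sound : ∀ {xs} → xs ∈ avoiders 0 n → Perm n xs × Avoider 0 xs
    sound = proj₁ (proj₂ (avoiders-correct 0 n))
    complete : ∀ {xs} → Perm n xs → Avoider 0 xs → xs ∈ avoiders 0 n
    complete = proj₂ (proj₂ (avoiders-correct 0 n))
    unique′ : Unique (map (fromList n) (avoiders 0 n))
    unique′ = Unique-map-leftInverse (fromList n) toList unique (toList-fromList ∘ proj₁ ∘ sound)
    sound′ : ∀ π → π ∈ map (fromList n) (avoiders 0 n) → D.InClass π
    sound′ π π∈ with ∈-map⁻ (fromList n) π∈
    ... | xs , xs∈ , refl with sound xs∈
    ... | perm , av =
      Avoider⇒InClass (fromList n xs) (subst (Perm n) (sym (toList-fromList perm)) perm) (subst (Avoider 0) (sym (toList-fromList perm)) av)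
    complete′ : ∀ π → D.InClass π → π ∈ map (fromList n) (avoiders 0 n)
    complete′ π inClass with InClass⇒Avoider π inClass
    ... | perm , av = subst (_∈ map (fromList n) (avoiders 0 n)) (fromList-toList π) (∈-map⁺ (fromList n) (complete perm av))

open import Defs
open import Data.Nat using (ℕ; _≥_; suc; s≤s)
open import Data.Integer using (+_)
open import Data.Product using (Σ; _×_; _,_)
open import Relation.Binary.PropositionalEquality using (_≡_)
open Counting using (count)
open ClosedForm using (count₀≡formula)
open GeneratingFunction using (generatingFunction)
open Bridge using (classCard)

theorem4p12 : Σ (ℕ → ℕ) λ a →
    (∀ (n : ℕ) → ClassCard n (a n)) ×
    (∀ (n : ℕ) → n ≥ 2 → + (a n) ≡ formula n) ×
    (∀ (m : ℕ) → (denominator ⋆ (λ k → + (a k))) m ≡ numerator m)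
theorem4p12 = count 0 , classCard , closedForm , generatingFunction
  where
  closedForm : ∀ n → n ≥ 2 → + count 0 n ≡ formula n
  closedForm (suc (suc m)) (s≤s (s≤s _)) = count₀≡formula m
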